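{- Let $N$ be a positive integer, $\boldsymbol{k}=(k_1,\dots,k_r)$ an index and $\boldsymbol{x}=(x_1,\dots,x_r)$ a tuple of indeterminates. Then: (1) Case $i=1$. (a) If $k_1>1$: $\dfrac{\Delta^{(N)}\mathrm{I}_{\boldsymbol{k}}^{(N)}(\boldsymbol{x})}{\Delta^{(N)}x_1}=-\dfrac{1}{x_1}\mathrm{I}_{\boldsymbol{k}^{\downarrow}_1}^{(N)}(\boldsymbol{x})$. (b) If $r=1$ and $k_1=1$: $\dfrac{\Delta^{(N)}\mathrm{I}_{\boldsymbol{k}}^{(N)}(\boldsymbol{x})}{\Delta^{(N)}x_1}=\dfrac{1}{x_1+N^{ -1}-1}-\dfrac{1}{x_1}$. (c) If $r>1$ and $k_1=1$: \[\frac{\Delta^{(N)}\mathrm{I}_{\boldsymbol{k}}^{(N)}(\boldsymbol{x})}{\Delta^{(N)}x_1} = -\frac{1}{x_1}\mathrm{I}_{\boldsymbol{k}^{\wedge}_1}^{(N)}(\boldsymbol{x}^{\wedge}_1)+\frac{1}{x_1+N^{ -1}-x_2}\left(\mathrm{I}_{\boldsymbol{k}^{\wedge}_1}^{(N)}(\boldsymbol{x}^{\wedge}_1)-\mathrm{I}_{\boldsymbol{k}^{\wedge}_1}^{(N)}(\boldsymbol{x}^{\wedge}_2)\Big|_{x_1+N^{ -1}}\right).\] (2) Case $r>1$ and $1<i<r$. (a) If $k_{i-1}>1$, $k_i>1$: \[\frac{\Delta^{(N)}\mathrm{I}_{\boldsymbol{k}}^{(N)}(\boldsymbol{x})}{\Delta^{(N)}x_i}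 = \frac{1}{x_i}\left(\mathrm{I}^{(N)}_{\boldsymbol{k}^{\downarrow}_{i-1}}(\boldsymbol{x})\Big|_{x_i+N^{ -1}}-\mathrm{I}^{(N)}_{\boldsymbol{k}^{\downarrow}_i}(\boldsymbol{x})\right).\] (b) If $k_{i-1}>1$, $k_i=1$: \begin{align*} \frac{\Delta^{(N)} \mathrm{I}_{\boldsymbol{k}}^{(N)}(\boldsymbol{x})}{\Delta^{(N)} x_i} &= \frac{1}{x_i}\left(\mathrm{I}_{\boldsymbol{k}_{i-1}^\downarrow}^{(N)}(\boldsymbol{x})\Big|_{x_i+N^{ -1}}-\mathrm{I}_{\boldsymbol{k}_i^\wedge}^{(N)}(\boldsymbol{x}_i^\wedge)\right) +\frac{1}{x_i+N^{ -1}-x_{i+1}}\left(\mathrm{I}_{\boldsymbol{k}_i^\wedge}^{(N)}(\boldsymbol{x}_i^\wedge) - \mathrm{I}_{\boldsymbol{k}_i^\wedge}^{(N)}(\boldsymbol{x}_{i+1}^\wedge)\Big|_{x_i+N^{ -1}}\right)\\ &\quad+\frac{1}{N}\frac{1}{x_i(x_i+N^{ -1}-x_{i+1})}\left(\mathrm{I}^{(N)}_{(\boldsymbol{k}_{i-1}^\downarrow)_i^\wedge}(\boldsymbol{x}_{i+1}^\wedge)\Big|_{x_i+N^{ -1}} - \mathrm{I}^{(N)}_{(\boldsymbol{k}_{i-1}^\downarrow)_i^\wedge}(\boldsymbol{x}_i^\wedge)\right). \end{align*} (c) If $k_{i-1}=1$, $k_i>1$: \begin{align*} \frac{\Delta^{(N)}\mathrm{I}_{\boldsymbol{k}}^{(N)}(\boldsymbol{x})}{\Delta^{(N)}x_i}&=\frac{1}{x_i-x_{i-1}}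 \left(\mathrm{I}_{\boldsymbol{k}_{i-1}^\wedge}^{(N)}(\boldsymbol{x}_{i-1}^\wedge) - \mathrm{I}_{\boldsymbol{k}_{i-1}^\wedge}^{(N)}(\boldsymbol{x}_i^\wedge) \right) + \frac{1}{x_i} \left(\mathrm{I}_{\boldsymbol{k}_{i-1}^\wedge}^{(N)}(\boldsymbol{x}_i^\wedge) - \mathrm{I}_{\boldsymbol{k}_i^\downarrow}^{(N)}(\boldsymbol{x})\right)\\ &\quad+\frac{1}{N}\frac{1}{x_i(x_i-x_{i-1})}\left(\mathrm{I}_{(\boldsymbol{k}^{\downarrow}_i)^{\wedge}_{i-1}}^{(N)}(\boldsymbol{x}^{\wedge}_i)-\mathrm{I}_{(\boldsymbol{k}^{\downarrow}_i)^{\wedge}_{i-1}}^{(N)}(\boldsymbol{x}^{\wedge}_{i-1})\right). \end{align*} (d) If $k_{i-1}=k_i=1$: \[ \frac{\Delta^{(N)} \mathrm{I}_{\boldsymbol{k}}^{(N)}(\boldsymbol{x})}{\Delta^{(N)} x_i} = \frac{1}{x_i - x_{i-1}} \left(\mathrm{I}_{\boldsymbol{k}_{i-1}^\wedge}^{(N)}(\boldsymbol{x}_{i-1}^\wedge) - \mathrm{I}_{\boldsymbol{k}_i^\wedge}^{(N)} (\boldsymbol{x}_i^\wedge)\right) + \frac{1}{x_i+N^{ -1}-x_{i+1}} \left(\mathrm{I}_{\boldsymbol{k}_i^\wedge}^{(N)}(\boldsymbol{x}_i^\wedge) - \mathrm{I}_{\boldsymbol{k}_i^\wedge}^{(N)}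 (\boldsymbol{x}_{i+1}^\wedge)\Big|_{x_i+N^{ -1}} \right). \] (3) Case $i=r>1$: the four formulas of (2) hold (with $i=r$) when one sets $x_{r+1}\coloneqq 1$ and interprets the terms $\mathrm{I}_{\boldsymbol{k}_r^\wedge}^{(N)} (\boldsymbol{x}_{r+1}^\wedge)\big|_{x_r+N^{ -1}}$ and $\mathrm{I}^{(N)}_{(\boldsymbol{k}_{r-1}^\downarrow)_r^\wedge}(\boldsymbol{x}_{r+1}^\wedge)\big|_{x_r+N^{ -1}}$ as $0$.
   Context: An index is a tuple of positive integers. For an index $\boldsymbol{k}=(k_1,\dots,k_r)$ and indeterminates $\boldsymbol{x}=(x_1,\dots,x_r)$, define the rational function \[\mathrm{I}_{\boldsymbol{k}}^{(N)}(\boldsymbol{x})\coloneqq\sum_{\substack{0< n_{j,1}\leq\cdots\leq n_{j,k_j}< N \ (1\leq j\leq r)\\ n_{j,k_j}<n_{j+1,1} \ (1\leq j<r)}}\prod_{j=1}^r\frac{1}{(n_{j,1}-Nx_j)n_{j,2}\cdots n_{j,k_j}},\] the sum over integers $n_{j,l}$. Notation: $\boldsymbol{k}^{\wedge}_{i}=(k_1,\dots,k_{i-1},k_{i+1},\dots,k_r)$ (delete $k_i$); $\boldsymbol{k}^{\downarrow}_{i}=(k_1,\dots,k_{i-1},k_i-1,k_{i+1},\dots,k_r)$ (for $k_i>1$); $\boldsymbol{x}^{\wedge}_{i}=(x_1,\dots,x_{i-1},x_{i+1},\dots,x_r)$; $(\boldsymbol{k}^\downarrow_{a})^\wedge_{b}$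 means first apply $\downarrow$ at position $a$ then delete the entry at position $b$. In each term the index and the tuple of variables have the same length and are fed into the definition above. For a function $f(\boldsymbol{x})$, $\frac{\Delta^{(N)}f(\boldsymbol{x})}{\Delta^{(N)}x_i}\coloneqq N\bigl(f(x_1,\dots,x_i+N^{ -1},\dots,x_r)-f(\boldsymbol{x})\bigr)$, and $f\big|_{x_i+N^{ -1}}$ denotes $f$ with the variable $x_i$ replaced by $x_i+N^{ -1}$ (wherever $x_i$ occurs in it). -}

module Defs where

open import Data.Nat as ℕ using (ℕ; zero; suc; _∸_; _<_)
open import Data.Integer using (+_)
open import Data.Rational using (ℚ; 0ℚ; 1ℚ; _+_; _-_; _*_; -_; 1/_; ≢-nonZero; _≟_)
import Data.Rational as Q
open import Data.List using (List; []; _∷_; upTo; map; foldr)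
open import Relation.Nullary using (yes; no)

⟦_⟧ : ℕ → ℚ
⟦ n ⟧ = (+ n) Q./ 1

-- total reciprocal (convention 1/0 = 0; only ever used under hypotheses
-- guaranteeing the argument is non-zero)
inv : ℚ → ℚ
inv q with q ≟ 0ℚ
... | yes _ = 0ℚ
... | no ne = 1/_ q {{≢-nonZero ne}}

Σ[_,_⟩ : ℕ → ℕ → (ℕ → ℚ) → ℚ
Σ[ lo , hi ⟩ f = foldr _+_ 0ℚ (map (λ j → f (lo ℕ.+ j)) (upTo (hi ∸ lo)))

-- I-after N lo k x : sum over all configurations of the definition of
--   I_k^(N)(x) with the additional constraint lo < n_{1,1}.
-- chain N c m k x : c further (weakly increasing) entries  m ≤ n ≤ ... < N,
--   each contributing 1/n, followed by the blocks k with first entry > last.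
mutual
  Iafter : ℕ → ℕ → List ℕ → List ℚ → ℚ
  Iafter N lo []       _        = 1ℚ
  Iafter N lo (k ∷ ks) []       = 0ℚ   -- length mismatch (never used)
  Iafter N lo (k ∷ ks) (x ∷ xs) =
    Σ[ suc lo , N ⟩ (λ n → inv (⟦ n ⟧ - ⟦ N ⟧ * x) * chain N (k ∸ 1) n ks xs)

  chain : ℕ → ℕ → ℕ → List ℕ → List ℚ → ℚ
  chain N zero    m ks xs = Iafter N m ks xs
  chain N (suc c) m ks xs = Σ[ m , N ⟩ (λ n → inv ⟦ n ⟧ * chain N c n ks xs)

I : ℕ → List ℕ → List ℚ → ℚ
I N ks xs = Iafter N 0 ks xs

N⁻¹ : ℕ → ℚ
N⁻¹ N = inv ⟦ N ⟧

open import Data.List using (_++_; length; [_])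
open import Data.List.Relation.Unary.All using (All)
open import Relation.Binary.PropositionalEquality using (_≡_; _≢_)
open import Data.Product using (_×_)

IsIndex : List ℕ → Set
IsIndex = All (λ k → 1 ℕ.≤ k)

PoleFree : ℕ → List ℚ → Set
PoleFree N = All (λ x → ∀ n → 0 < n → n < N → ⟦ n ⟧ - ⟦ N ⟧ * x ≢ 0ℚ)

-- Δ^(N) f / Δ^(N) x_i, given f at the shifted point and at the point
Δ : ℕ → ℚ → ℚ → ℚ
Δ N fshift f = ⟦ N ⟧ * (fshift - f)

Case1a : ℕ → Set
Case1a N = ∀ (k1 : ℕ) (b : List ℕ) (x1 : ℚ) (z : List ℚ) →
  1 < k1 → IsIndex b → length b ≡ length z →
  PoleFree N (x1 ∷ z) → PoleFree N ((x1 + N⁻¹ N) ∷ z) → x1 ≢ 0ℚ →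
  Δ N (I N (k1 ∷ b) ((x1 + N⁻¹ N) ∷ z)) (I N (k1 ∷ b) (x1 ∷ z))
    ≡ - (inv x1 * I N ((k1 ∸ 1) ∷ b) (x1 ∷ z))

Case1b : ℕ → Set
Case1b N = ∀ (x1 : ℚ) →
  PoleFree N [ x1 ] → PoleFree N [ x1 + N⁻¹ N ] → x1 ≢ 0ℚ →
  x1 + N⁻¹ N - 1ℚ ≢ 0ℚ →
  Δ N (I N [ 1 ] [ x1 + N⁻¹ N ]) (I N [ 1 ] [ x1 ])
    ≡ inv (x1 + N⁻¹ N - 1ℚ) - inv x1

Case1c : ℕ → Set
Case1c N = ∀ (k2 : ℕ) (b : List ℕ) (x1 x2 : ℚ) (z : List ℚ) →
  1 ℕ.≤ k2 → IsIndex b → length b ≡ length z →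
  PoleFree N (x1 ∷ x2 ∷ z) → PoleFree N ((x1 + N⁻¹ N) ∷ x2 ∷ z) → x1 ≢ 0ℚ →
  x1 + N⁻¹ N - x2 ≢ 0ℚ →
  Δ N (I N (1 ∷ k2 ∷ b) ((x1 + N⁻¹ N) ∷ x2 ∷ z)) (I N (1 ∷ k2 ∷ b) (x1 ∷ x2 ∷ z))
    ≡ - (inv x1 * I N (k2 ∷ b) (x2 ∷ z))
      + inv (x1 + N⁻¹ N - x2)
          * (I N (k2 ∷ b) (x2 ∷ z) - I N (k2 ∷ b) ((x1 + N⁻¹ N) ∷ z))

-- Case (2): 1 < i < r.  k = a ++ (p , q , c) ++ b,  x = y ++ (u , v , w) ++ z,
-- where p = k_{i-1}, q = k_i, c = k_{i+1}, u = x_{i-1}, v = x_i, w = x_{i+1}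
-- (so i - 1 = length a + 1).
Hyp2 : ℕ → List ℕ → ℕ → ℕ → ℕ → List ℕ → List ℚ → ℚ → ℚ → ℚ → List ℚ → Set
Hyp2 N a p q c b y u v w z =
  IsIndex (a ++ p ∷ q ∷ c ∷ b) × length a ≡ length y × length b ≡ length z ×
  PoleFree N (y ++ u ∷ v ∷ w ∷ z) × PoleFree N (y ++ u ∷ (v + N⁻¹ N) ∷ w ∷ z) ×
  v ≢ 0ℚ

LHS2 : ℕ → List ℕ → ℕ → ℕ → ℕ → List ℕ → List ℚ → ℚ → ℚ → ℚ → List ℚ → ℚ
LHS2 N a p q c b y u v w z =
  Δ N (I N (a ++ p ∷ q ∷ c ∷ b) (y ++ u ∷ (v + N⁻¹ N) ∷ w ∷ z))
      (I N (a ++ p ∷ q ∷ c ∷ b) (y ++ u ∷ v ∷ w ∷ z))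

Case2a : ℕ → Set
Case2a N = ∀ a p q c b y u v w z → Hyp2 N a p q c b y u v w z → 1 < p → 1 < q →
  LHS2 N a p q c b y u v w z
    ≡ inv v * (I N (a ++ (p ∸ 1) ∷ q ∷ c ∷ b) (y ++ u ∷ (v + N⁻¹ N) ∷ w ∷ z)
               - I N (a ++ p ∷ (q ∸ 1) ∷ c ∷ b) (y ++ u ∷ v ∷ w ∷ z))

Case2b : ℕ → Set
Case2b N = ∀ a p c b y u v w z → Hyp2 N a p 1 c b y u v w z → 1 < p →
  v + N⁻¹ N - w ≢ 0ℚ →
  LHS2 N a p 1 c b y u v w z
    ≡ inv v * (I N (a ++ (p ∸ 1) ∷ 1 ∷ c ∷ b) (y ++ u ∷ (v + N⁻¹ N) ∷ w ∷ z)
               - I N (a ++ p ∷ c ∷ b) (y ++ u ∷ w ∷ z))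
      + inv (v + N⁻¹ N - w)
          * (I N (a ++ p ∷ c ∷ b) (y ++ u ∷ w ∷ z)
             - I N (a ++ p ∷ c ∷ b) (y ++ u ∷ (v + N⁻¹ N) ∷ z))
      + N⁻¹ N * inv (v * (v + N⁻¹ N - w))
          * (I N (a ++ (p ∸ 1) ∷ c ∷ b) (y ++ u ∷ (v + N⁻¹ N) ∷ z)
             - I N (a ++ (p ∸ 1) ∷ c ∷ b) (y ++ u ∷ w ∷ z))

Case2c : ℕ → Set
Case2c N = ∀ a q c b y u v w z → Hyp2 N a 1 q c b y u v w z → 1 < q →
  v - u ≢ 0ℚ →
  LHS2 N a 1 q c b y u v w z
    ≡ inv (v - u) * (I N (a ++ q ∷ c ∷ b) (y ++ v ∷ w ∷ z)
                     - I N (a ++ q ∷ c ∷ b) (y ++ u ∷ w ∷ z))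
      + inv v * (I N (a ++ q ∷ c ∷ b) (y ++ u ∷ w ∷ z)
                 - I N (a ++ 1 ∷ (q ∸ 1) ∷ c ∷ b) (y ++ u ∷ v ∷ w ∷ z))
      + N⁻¹ N * inv (v * (v - u))
          * (I N (a ++ (q ∸ 1) ∷ c ∷ b) (y ++ u ∷ w ∷ z)
             - I N (a ++ (q ∸ 1) ∷ c ∷ b) (y ++ v ∷ w ∷ z))

Case2d : ℕ → Set
Case2d N = ∀ a c b y u v w z → Hyp2 N a 1 1 c b y u v w z →
  v - u ≢ 0ℚ → v + N⁻¹ N - w ≢ 0ℚ →
  LHS2 N a 1 1 c b y u v w z
    ≡ inv (v - u) * (I N (a ++ 1 ∷ c ∷ b) (y ++ v ∷ w ∷ z)
                     - I N (a ++ 1 ∷ c ∷ b) (y ++ u ∷ w ∷ z))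
      + inv (v + N⁻¹ N - w)
          * (I N (a ++ 1 ∷ c ∷ b) (y ++ u ∷ w ∷ z)
             - I N (a ++ 1 ∷ c ∷ b) (y ++ u ∷ (v + N⁻¹ N) ∷ z))

-- Case (3): i = r > 1.  k = a ++ (p , q),  x = y ++ (u , v),
-- with p = k_{r-1}, q = k_r, u = x_{r-1}, v = x_r; x_{r+1} := 1 and the
-- terms I_{k_r^∧}(x_{r+1}^∧)|_{x_r+1/N}, I_{(k_{r-1}^↓)_r^∧}(x_{r+1}^∧)|_{x_r+1/N}
-- are 0 (written as 0ℚ below).
Hyp3 : ℕ → List ℕ → ℕ → ℕ → List ℚ → ℚ → ℚ → Set
Hyp3 N a p q y u v =
  IsIndex (a ++ p ∷ q ∷ []) × length a ≡ length y ×
  PoleFree N (y ++ u ∷ v ∷ []) × PoleFree N (y ++ u ∷ (v + N⁻¹ N) ∷ []) ×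
  v ≢ 0ℚ

LHS3 : ℕ → List ℕ → ℕ → ℕ → List ℚ → ℚ → ℚ → ℚ
LHS3 N a p q y u v =
  Δ N (I N (a ++ p ∷ q ∷ []) (y ++ u ∷ (v + N⁻¹ N) ∷ []))
      (I N (a ++ p ∷ q ∷ []) (y ++ u ∷ v ∷ []))

Case3a : ℕ → Set
Case3a N = ∀ a p q y u v → Hyp3 N a p q y u v → 1 < p → 1 < q →
  LHS3 N a p q y u v
    ≡ inv v * (I N (a ++ (p ∸ 1) ∷ q ∷ []) (y ++ u ∷ (v + N⁻¹ N) ∷ [])
               - I N (a ++ p ∷ (q ∸ 1) ∷ []) (y ++ u ∷ v ∷ []))

Case3b : ℕ → Set
Case3b N = ∀ a p y u v → Hyp3 N a p 1 y u v → 1 < p →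
  v + N⁻¹ N - 1ℚ ≢ 0ℚ →
  LHS3 N a p 1 y u v
    ≡ inv v * (I N (a ++ (p ∸ 1) ∷ 1 ∷ []) (y ++ u ∷ (v + N⁻¹ N) ∷ [])
               - I N (a ++ p ∷ []) (y ++ u ∷ []))
      + inv (v + N⁻¹ N - 1ℚ)
          * (I N (a ++ p ∷ []) (y ++ u ∷ []) - 0ℚ)
      + N⁻¹ N * inv (v * (v + N⁻¹ N - 1ℚ))
          * (0ℚ - I N (a ++ (p ∸ 1) ∷ []) (y ++ u ∷ []))

Case3c : ℕ → Set
Case3c N = ∀ a q y u v → Hyp3 N a 1 q y u v → 1 < q →
  v - u ≢ 0ℚ →
  LHS3 N a 1 q y u v
    ≡ inv (v - u) * (I N (a ++ q ∷ []) (y ++ v ∷ [])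
                     - I N (a ++ q ∷ []) (y ++ u ∷ []))
      + inv v * (I N (a ++ q ∷ []) (y ++ u ∷ [])
                 - I N (a ++ 1 ∷ (q ∸ 1) ∷ []) (y ++ u ∷ v ∷ []))
      + N⁻¹ N * inv (v * (v - u))
          * (I N (a ++ (q ∸ 1) ∷ []) (y ++ u ∷ [])
             - I N (a ++ (q ∸ 1) ∷ []) (y ++ v ∷ []))

Case3d : ℕ → Set
Case3d N = ∀ a y u v → Hyp3 N a 1 1 y u v →
  v - u ≢ 0ℚ → v + N⁻¹ N - 1ℚ ≢ 0ℚ →
  LHS3 N a 1 1 y u v
    ≡ inv (v - u) * (I N (a ++ 1 ∷ []) (y ++ v ∷ [])
                     - I N (a ++ 1 ∷ []) (y ++ u ∷ []))
      + inv (v + N⁻¹ N - 1ℚ)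
          * (I N (a ++ 1 ∷ []) (y ++ u ∷ []) - 0ℚ)

{-# OPTIONS --safe #-}
module Submission where

-- Write g x n = 1/(n - N x) and regard every nested sum as an operator on functions F of the lower
-- summation bound: A x F m = Σ_{m<n<N} g x n F n opens a block with variable x, and
-- L F m = Σ_{m≤n<N} F n / n adds an entry to a block, so that I_k(x) is a composite of A's and L's
-- applied to the constant 1.  Since g (x + 1/N) (n + 1) = g x n, moving x_i to x_i + 1/N shifts the
-- summation variable of its block by one; comparing the two sums term by term and absorbing the
-- products of g's by partial fractions, such as
--   N g v n / n = (g v n - 1/n) / v,   N g u n g v n = (g v n - g u n) / (v - u),
-- expresses Δ^(N) of the block of x_i again through A and L, at every lower bound.  The blocks in front
-- of it act linearly, which carries these identities to the whole of I_k.  Case (3) is case (2) with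
-- nothing after x_i: the empty index has value 1, and N g v (N - 1) = -1/(v + 1/N - 1) is where the
-- convention x_{r+1} = 1 comes from.

open import Defs
open import Data.Nat using (ℕ; zero; suc; _∸_; _<_; _≤_; z≤n; s≤s)
import Data.Nat.Properties as ℕₚ
open import Data.Nat.Coprimality using (1-coprimeTo)
import Data.Nat.Coprimality as Coprime
import Data.Integer as ℤ
import Data.Integer.Properties as ℤₚ
open import Data.Rational using (ℚ; 0ℚ; 1ℚ; _+_; _-_; _*_; -_; _/_; ≢-nonZero; mkℚ; ↥_)
open import Data.Rational.Properties
  using (_≟_; +-*-commutativeRing; *-inverseʳ; ↥p/↧p≡p; p≡0⇒↥p≡0; 1≢0; *-zeroˡ; +-assoc)
open import Data.List using (List; []; _∷_; [_]; _++_; length; foldr)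
open import Data.List.Properties using (map-applyUpTo)
open import Data.List.Relation.Unary.All using (All; []; _∷_; head; tail)
open import Data.List.Relation.Unary.All.Properties using (++⁻ʳ)
open import Data.Bool using (Bool; true; false)
open import Data.Product using (_×_; _,_; proj₁; proj₂)
open import Data.Empty using (⊥-elim)
open import Data.Unit using (⊤; tt)
open import Function using (_∘_; id)
open import Relation.Nullary using (yes; no)
open import Relation.Nullary.Decidable using (dec⇒maybe)
open import Relation.Binary.PropositionalEquality
  using (_≡_; _≢_; refl; sym; trans; cong; cong₂; module ≡-Reasoning)
open import Tactic.RingSolver using (solve-∀)
open import Tactic.RingSolver.Core.AlmostCommutativeRing using (AlmostCommutativeRing; fromCommutativeRing)

open ≡-Reasoning

ℚ-ring : AlmostCommutativeRing _ _
ℚ-ring = fromCommutativeRing +-*-commutativeRing (λ q → dec⇒maybe (0ℚ ≟ q))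

𝟎 𝟏 : ℕ → ℚ
𝟎 _ = 0ℚ
𝟏 _ = 1ℚ

-- c₁ * (f s₁ - f t₁) + ⋯ + cₖ * (f sₖ - f tₖ), nested to the left like the identities in Defs.
combination-from : {S : Set} → (S → ℚ) → ℚ → List (ℚ × S × S) → ℚ
combination-from f acc []                 = acc
combination-from f acc ((c , s , t) ∷ ds) = combination-from f (acc + c * (f s - f t)) ds

combination : {S : Set} → (S → ℚ) → List (ℚ × S × S) → ℚ
combination f []                 = 0ℚ
combination f ((c , s , t) ∷ ds) = combination-from f (c * (f s - f t)) ds

combination-cong : ∀ {S : Set} {f f′ : S → ℚ} → (∀ s → f s ≡ f′ s) → ∀ ds →
  combination f ds ≡ combination f′ ds
combination-cong f≗f′ []                 = refl
combination-cong {f = f} {f′} f≗f′ ((c , s , t) ∷ ds) = from (term c s t) ds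
  where
  term : ∀ c s t → c * (f s - f t) ≡ c * (f′ s - f′ t)
  term c s t = cong₂ (λ a b → c * (a - b)) (f≗f′ s) (f≗f′ t)
  from : ∀ {acc acc′} → acc ≡ acc′ → ∀ ds →
    combination-from f acc ds ≡ combination-from f′ acc′ ds
  from acc≡ []                 = acc≡
  from acc≡ ((c , s , t) ∷ ds) = from (cong₂ _+_ acc≡ (term c s t)) ds

Equations : List (ℚ × ℚ × ℚ) → Set
Equations = All (λ { (_ , l , r) → l ≡ r })

combination-of-equations : ∀ hs → Equations hs → combination id hs ≡ 0ℚ
combination-of-equations []                  []          = refl
combination-of-equations ((c , l , _) ∷ hs) (refl ∷ eqs) = trans (from _ hs eqs) (cancel c l)
  where
  cancel : ∀ c l → c * (l - l) ≡ 0ℚ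
  cancel = solve-∀ ℚ-ring
  annul : ∀ acc c l → acc + c * (l - l) ≡ acc
  annul = solve-∀ ℚ-ring
  from : ∀ acc hs → Equations hs → combination-from id acc hs ≡ acc
  from acc []                  []          = refl
  from acc ((c , l , _) ∷ hs) (refl ∷ eqs) = trans (from _ hs eqs) (annul acc c l)

-- The ring solver cannot use hypotheses: it proves the certificate a ≡ b + Σ cᵢ * (lᵢ - rᵢ) as a
-- polynomial identity, with inverses as atoms, and the equations lᵢ ≡ rᵢ then give a ≡ b.
by-combination : ∀ {a b} hs → a ≡ b + combination id hs → Equations hs → a ≡ b
by-combination {a} {b} hs certificate eqs = begin
  a                       ≡⟨ certificate ⟩
  b + combination id hs   ≡⟨ cong (b +_) (combination-of-equations hs eqs) ⟩
  b + 0ℚ                  ≡⟨ right-identity b ⟩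
  b                       ∎
  where
  right-identity : ∀ b → b + 0ℚ ≡ b
  right-identity = solve-∀ ℚ-ring

inv-inverseʳ : ∀ {q} → q ≢ 0ℚ → q * inv q ≡ 1ℚ
inv-inverseʳ {q} q≢0 with q ≟ 0ℚ
... | yes q≡0  = ⊥-elim (q≢0 q≡0)
... | no  q≢0′ = *-inverseʳ q {{≢-nonZero q≢0′}}

inv-unique : ∀ {a b} → a * b ≡ 1ℚ → inv a ≡ b
inv-unique {a} {b} ab≡1 =
  by-combination ((- inv a , a * b , 1ℚ) ∷ (b , a * inv a , 1ℚ) ∷ [])
    (certificate a b (inv a)) (ab≡1 ∷ inv-inverseʳ a≢0 ∷ [])
  where
  a≢0 : a ≢ 0ℚ
  a≢0 a≡0 = 1≢0 (trans (sym ab≡1) (trans (cong (_* b) a≡0) (*-zeroˡ b)))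
  certificate : ∀ a b a⁻¹ → a⁻¹ ≡ b + ((- a⁻¹) * (a * b - 1ℚ) + b * (a * a⁻¹ - 1ℚ))
  certificate = solve-∀ ℚ-ring

inv-* : ∀ {a b} → a ≢ 0ℚ → b ≢ 0ℚ → inv (a * b) ≡ inv a * inv b
inv-* {a} {b} a≢0 b≢0 = inv-unique {a = a * b}
  (by-combination ((b * inv b , a * inv a , 1ℚ) ∷ (1ℚ , b * inv b , 1ℚ) ∷ [])
    (certificate a b (inv a) (inv b)) (inv-inverseʳ a≢0 ∷ inv-inverseʳ b≢0 ∷ []))
  where
  certificate : ∀ a b a⁻¹ b⁻¹ →
    a * b * (a⁻¹ * b⁻¹) ≡ 1ℚ + (b * b⁻¹ * (a * a⁻¹ - 1ℚ) + 1ℚ * (b * b⁻¹ - 1ℚ))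
  certificate = solve-∀ ℚ-ring

⟦_⟧≡mkℚ : ∀ n → ⟦ n ⟧ ≡ mkℚ (ℤ.+ n) 0 (Coprime.sym (1-coprimeTo n))
⟦ n ⟧≡mkℚ = ↥p/↧p≡p (mkℚ (ℤ.+ n) 0 (Coprime.sym (1-coprimeTo n)))

⟦suc⟧ : ∀ n → ⟦ suc n ⟧ ≡ ⟦ n ⟧ + 1ℚ
⟦suc⟧ n = begin
  ⟦ suc n ⟧                                            ≡⟨ cong (_/ 1) (sym numerator) ⟩
  (ℤ.+ n ℤ.* ℤ.+ 1 ℤ.+ ℤ.+ 1 ℤ.* ℤ.+ 1) / 1             ≡⟨⟩
  mkℚ (ℤ.+ n) 0 (Coprime.sym (1-coprimeTo n)) + 1ℚ     ≡⟨ cong (_+ 1ℚ) ⟦ n ⟧≡mkℚ ⟨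
  ⟦ n ⟧ + 1ℚ                                           ∎
  where
  numerator : ℤ.+ n ℤ.* ℤ.+ 1 ℤ.+ ℤ.+ 1 ℤ.* ℤ.+ 1 ≡ ℤ.+ suc n
  numerator = trans (cong (ℤ._+ ℤ.+ 1) (ℤₚ.*-identityʳ (ℤ.+ n))) (cong ℤ.+_ (ℕₚ.+-comm n 1))

⟦suc⟧≢0 : ∀ n → ⟦ suc n ⟧ ≢ 0ℚ
⟦suc⟧≢0 n ⟦suc⟧≡0
  with trans (cong ↥_ (sym ⟦ suc n ⟧≡mkℚ)) (p≡0⇒↥p≡0 _ ⟦suc⟧≡0)
... | ()

Σ-first : ∀ lo hi (f : ℕ → ℚ) → lo < hi → Σ[ lo , hi ⟩ f ≡ f lo + Σ[ suc lo , hi ⟩ f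
Σ-first zero     (suc hi) f _          = cong (λ xs → f 0 + foldr _+_ 0ℚ xs)
  (trans (map-applyUpTo suc f hi) (sym (map-applyUpTo id (f ∘ suc) hi)))
Σ-first (suc lo) (suc hi) f (s≤s lo<hi) = Σ-first lo hi (f ∘ suc) lo<hi

Σ-empty : ∀ lo hi (f : ℕ → ℚ) → hi ≤ lo → Σ[ lo , hi ⟩ f ≡ 0ℚ
Σ-empty zero     zero     f _           = refl
Σ-empty (suc lo) zero     f _           = refl
Σ-empty (suc lo) (suc hi) f (s≤s hi≤lo) = Σ-empty lo hi (f ∘ suc) hi≤lo

Σ-cong : ∀ lo hi {f g : ℕ → ℚ} → (∀ n → lo ≤ n → n < hi → f n ≡ g n) →
  Σ[ lo , hi ⟩ f ≡ Σ[ lo , hi ⟩ g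
Σ-cong zero     zero     f≗g = refl
Σ-cong (suc lo) zero     f≗g = refl
Σ-cong zero     (suc hi) {f} {g} f≗g = begin
  Σ[ 0 , suc hi ⟩ f              ≡⟨ Σ-first 0 (suc hi) f (s≤s z≤n) ⟩
  f 0 + Σ[ 0 , hi ⟩ (f ∘ suc)    ≡⟨ cong₂ _+_ (f≗g 0 z≤n (s≤s z≤n))
                                      (Σ-cong 0 hi (λ n _ n<hi → f≗g (suc n) z≤n (s≤s n<hi))) ⟩
  g 0 + Σ[ 0 , hi ⟩ (g ∘ suc)    ≡⟨ Σ-first 0 (suc hi) g (s≤s z≤n) ⟨
  Σ[ 0 , suc hi ⟩ g              ∎
Σ-cong (suc lo) (suc hi) f≗g =
  Σ-cong lo hi (λ n lo≤n n<hi → f≗g (suc n) (s≤s lo≤n) (s≤s n<hi))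

Σ-linear : ∀ lo hi (F : ℕ → ℚ) c G →
  Σ[ lo , hi ⟩ (λ n → F n + c * G n) ≡ Σ[ lo , hi ⟩ F + c * Σ[ lo , hi ⟩ G
Σ-linear zero     zero     F c G = empty c
  where
  empty : ∀ c → 0ℚ ≡ 0ℚ + c * 0ℚ
  empty = solve-∀ ℚ-ring
Σ-linear (suc lo) zero     F c G = Σ-linear zero zero F c G
Σ-linear zero     (suc hi) F c G = begin
  Σ[ 0 , suc hi ⟩ (λ n → F n + c * G n)
    ≡⟨ Σ-first 0 (suc hi) (λ n → F n + c * G n) (s≤s z≤n) ⟩
  (F 0 + c * G 0) + Σ[ 0 , hi ⟩ (λ n → F (suc n) + c * G (suc n))
    ≡⟨ cong ((F 0 + c * G 0) +_) (Σ-linear zero hi (F ∘ suc) c (G ∘ suc)) ⟩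
  (F 0 + c * G 0) + (Σ[ 0 , hi ⟩ (F ∘ suc) + c * Σ[ 0 , hi ⟩ (G ∘ suc))
    ≡⟨ regroup (F 0) (G 0) c (Σ[ 0 , hi ⟩ (F ∘ suc)) (Σ[ 0 , hi ⟩ (G ∘ suc)) ⟩
  (F 0 + Σ[ 0 , hi ⟩ (F ∘ suc)) + c * (G 0 + Σ[ 0 , hi ⟩ (G ∘ suc))
    ≡⟨ cong₂ (λ s t → s + c * t) (Σ-first 0 (suc hi) F (s≤s z≤n))
                                 (Σ-first 0 (suc hi) G (s≤s z≤n)) ⟨
  Σ[ 0 , suc hi ⟩ F + c * Σ[ 0 , suc hi ⟩ G ∎
  where
  regroup : ∀ a b c s t → (a + c * b) + (s + c * t) ≡ (a + s) + c * (b + t)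
  regroup = solve-∀ ℚ-ring
Σ-linear (suc lo) (suc hi) F c G = Σ-linear lo hi (F ∘ suc) c (G ∘ suc)

Σ-last : ∀ lo hi (f : ℕ → ℚ) → lo ≤ hi → Σ[ lo , suc hi ⟩ f ≡ Σ[ lo , hi ⟩ f + f hi
Σ-last zero     zero     f _ = swap (f 0)
  where
  swap : ∀ a → a + 0ℚ ≡ 0ℚ + a
  swap = solve-∀ ℚ-ring
Σ-last zero     (suc hi) f _ = begin
  Σ[ 0 , suc (suc hi) ⟩ f                    ≡⟨ Σ-first 0 (suc (suc hi)) f (s≤s z≤n) ⟩
  f 0 + Σ[ 0 , suc hi ⟩ (f ∘ suc)            ≡⟨ cong (f 0 +_) (Σ-last 0 hi (f ∘ suc) z≤n) ⟩
  f 0 + (Σ[ 0 , hi ⟩ (f ∘ suc) + f (suc hi)) ≡⟨ +-assoc (f 0) _ (f (suc hi)) ⟨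
  (f 0 + Σ[ 0 , hi ⟩ (f ∘ suc)) + f (suc hi) ≡⟨ cong (_+ f (suc hi))
                                                     (Σ-first 0 (suc hi) f (s≤s z≤n)) ⟨
  Σ[ 0 , suc hi ⟩ f + f (suc hi)            ∎
Σ-last (suc lo) (suc hi) f (s≤s lo≤hi) = Σ-last lo hi (f ∘ suc) lo≤hi

record IsLinear (P : ℕ → Set) (Φ : (ℕ → ℚ) → ℚ) : Set where
  field
    cong-on : ∀ {F G} → (∀ n → P n → F n ≡ G n) → Φ F ≡ Φ G
    linear  : ∀ F c G → Φ (λ n → F n + c * G n) ≡ Φ F + c * Φ G

  zero-hom : Φ 𝟎 ≡ 0ℚ
  zero-hom = by-combination ((- 1ℚ , Φ 𝟎 , Φ 𝟎 + 1ℚ * Φ 𝟎) ∷ [])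
    (certificate (Φ 𝟎)) (trans (cong-on (λ _ _ → refl)) (linear 𝟎 1ℚ 𝟎) ∷ [])
    where
    certificate : ∀ x → x ≡ 0ℚ + (- 1ℚ) * (x - (x + 1ℚ * x))
    certificate = solve-∀ ℚ-ring

  add-difference : ∀ A c F G → Φ (λ n → A n + c * (F n - G n)) ≡ Φ A + c * (Φ F - Φ G)
  add-difference A c F G = begin
    Φ (λ n → A n + c * (F n - G n))         ≡⟨ cong-on (λ n _ → split (A n) c (F n) (G n)) ⟩
    Φ (λ n → (A n + c * F n) + (- c) * G n) ≡⟨ linear _ (- c) G ⟩
    Φ (λ n → A n + c * F n) + (- c) * Φ G   ≡⟨ cong (_+ (- c) * Φ G) (linear A c F) ⟩
    (Φ A + c * Φ F) + (- c) * Φ G           ≡⟨ split (Φ A) c (Φ F) (Φ G) ⟨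
    Φ A + c * (Φ F - Φ G)                   ∎
    where
    split : ∀ a c f g → a + c * (f - g) ≡ (a + c * f) + (- c) * g
    split = solve-∀ ℚ-ring

  difference : ∀ c F G → Φ (λ n → c * (F n - G n)) ≡ c * (Φ F - Φ G)
  difference c F G = begin
    Φ (λ n → c * (F n - G n))             ≡⟨ cong-on (λ n _ → unpad _) ⟨
    Φ (λ n → 0ℚ + c * (F n - G n))        ≡⟨ add-difference 𝟎 c F G ⟩
    Φ 𝟎 + c * (Φ F - Φ G)                 ≡⟨ cong (_+ c * (Φ F - Φ G)) zero-hom ⟩
    0ℚ + c * (Φ F - Φ G)                  ≡⟨ unpad _ ⟩
    c * (Φ F - Φ G)                       ∎
    where
    unpad : ∀ a → 0ℚ + a ≡ a
    unpad = solve-∀ ℚ-ring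

  scale : ∀ c F → Φ (λ n → c * F n) ≡ c * Φ F
  scale c F = begin
    Φ (λ n → c * F n)          ≡⟨ cong-on (λ n _ → unpad c (F n)) ⟨
    Φ (λ n → c * (F n - 0ℚ))   ≡⟨ difference c F 𝟎 ⟩
    c * (Φ F - Φ 𝟎)            ≡⟨ cong (λ t → c * (Φ F - t)) zero-hom ⟩
    c * (Φ F - 0ℚ)             ≡⟨ unpad c (Φ F) ⟩
    c * Φ F                    ∎
    where
    unpad : ∀ c f → c * (f - 0ℚ) ≡ c * f
    unpad = solve-∀ ℚ-ring

  module _ {S : Set} (ev : S → ℕ → ℚ) where

    combination-from-hom : ∀ A ds →
      combination-from (Φ ∘ ev) (Φ A) ds ≡ Φ (λ n → combination-from (λ s → ev s n) (A n) ds)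
    combination-from-hom A []                 = refl
    combination-from-hom A ((c , s , t) ∷ ds) = begin
      combination-from (Φ ∘ ev) (Φ A + c * (Φ (ev s) - Φ (ev t))) ds
        ≡⟨ cong (λ a → combination-from (Φ ∘ ev) a ds) (add-difference A c (ev s) (ev t)) ⟨
      combination-from (Φ ∘ ev) (Φ (λ n → A n + c * (ev s n - ev t n))) ds
        ≡⟨ combination-from-hom _ ds ⟩
      Φ (λ n → combination-from (λ s → ev s n) (A n + c * (ev s n - ev t n)) ds) ∎

    combination-hom : ∀ ds → combination (Φ ∘ ev) ds ≡ Φ (λ n → combination (λ s → ev s n) ds)
    combination-hom []                 = sym zero-hom
    combination-hom ((c , s , t) ∷ ds) = begin
      combination-from (Φ ∘ ev) (c * (Φ (ev s) - Φ (ev t))) ds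
        ≡⟨ cong (λ a → combination-from (Φ ∘ ev) a ds) (difference c (ev s) (ev t)) ⟨
      combination-from (Φ ∘ ev) (Φ (λ n → c * (ev s n - ev t n))) ds
        ≡⟨ combination-from-hom _ ds ⟩
      Φ (λ n → combination-from (λ s → ev s n) (c * (ev s n - ev t n)) ds) ∎

    lift : ∀ ds es →
      (∀ n → P n → combination (λ s → ev s n) ds ≡ combination (λ s → ev s n) es) →
      combination (Φ ∘ ev) ds ≡ combination (Φ ∘ ev) es
    lift ds es pointwise = begin
      combination (Φ ∘ ev) ds                   ≡⟨ combination-hom ds ⟩
      Φ (λ n → combination (λ s → ev s n) ds)   ≡⟨ cong-on pointwise ⟩
      Φ (λ n → combination (λ s → ev s n) es)   ≡⟨ combination-hom es ⟨
      combination (Φ ∘ ev) es                   ∎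

Σ-is-linear : ∀ lo hi → IsLinear (λ n → lo ≤ n × n < hi) Σ[ lo , hi ⟩
Σ-is-linear lo hi = record
  { cong-on = λ F≗G → Σ-cong lo hi (λ n lo≤n n<hi → F≗G n (lo≤n , n<hi))
  ; linear  = Σ-linear lo hi
  }

module Truncated (h : ℕ) where

  N : ℕ
  N = suc h

  𝐍 ι : ℚ
  𝐍 = ⟦ N ⟧
  ι = N⁻¹ N

  _⁺ : ℚ → ℚ
  x ⁺ = x + ι

  g : ℚ → ℕ → ℚ
  g x n = inv (⟦ n ⟧ - 𝐍 * x)

  _⊙_ : ℚ → (ℕ → ℚ) → ℕ → ℚ
  (x ⊙ F) n = g x n * F n

  _/ℕ : (ℕ → ℚ) → ℕ → ℚ
  (F /ℕ) n = inv ⟦ n ⟧ * F n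

  S A : ℚ → (ℕ → ℚ) → ℕ → ℚ
  S x F m = Σ[ m , N ⟩ (x ⊙ F)
  A x F m = S x F (suc m)

  L : (ℕ → ℚ) → ℕ → ℚ
  L F m = Σ[ m , N ⟩ (F /ℕ)

  -- iterated from the inside, so that the entry next to the following block is exposed definitionally
  L^ : ℕ → (ℕ → ℚ) → ℕ → ℚ
  L^ zero    F = F
  L^ (suc c) F = L^ c (L F)

  -- I with the value 1 of the empty index replaced by the continuation K: Iafter N m ks xs is
  -- Iᴷ 𝟏 ks xs m (I-as-Iᴷ).
  Iᴷ : (ℕ → ℚ) → List ℕ → List ℚ → ℕ → ℚ
  Iᴷ K []       _        = K
  Iᴷ K (_ ∷ _)  []       = 𝟎
  Iᴷ K (k ∷ ks) (x ∷ xs) = A x (L^ (k ∸ 1) (Iᴷ K ks xs))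

  _∈[_,N⟩ : ℕ → ℕ → Set
  n ∈[ m ,N⟩ = m ≤ n × n < N

  weighted-linear : ∀ (w : ℕ → ℚ) m →
    IsLinear (_∈[ m ,N⟩) (λ F → Σ[ m , N ⟩ (λ n → w n * F n))
  weighted-linear w m = record
    { cong-on = λ F≗G → Σ-cong m N (λ n m≤n n<N → cong (w n *_) (F≗G n (m≤n , n<N)))
    ; linear  = λ F c G → trans (Σ-cong m N (λ n _ _ → distrib (w n) (F n) c (G n)))
                                (Σ-linear m N (λ n → w n * F n) c (λ n → w n * G n))
    }
    where
    distrib : ∀ w f c g → w * (f + c * g) ≡ w * f + c * (w * g)
    distrib = solve-∀ ℚ-ring

  A-linear : ∀ x m → IsLinear (_∈[ suc m ,N⟩) (λ F → A x F m)
  A-linear x m = weighted-linear (g x) (suc m)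

  L-linear : ∀ m → IsLinear (_∈[ m ,N⟩) (λ F → L F m)
  L-linear = weighted-linear (λ n → inv ⟦ n ⟧)

  evaluation-linear : ∀ {m} → m < N → IsLinear (_∈[ m ,N⟩) (λ F → F m)
  evaluation-linear m<N = record
    { cong-on = λ F≗G → F≗G _ (ℕₚ.≤-refl , m<N)
    ; linear  = λ _ _ _ → refl
    }

  zero-linear : ∀ {P} → IsLinear P (λ _ → 0ℚ)
  zero-linear = record { cong-on = λ _ → refl ; linear = λ _ c _ → padding c }
    where
    padding : ∀ c → 0ℚ ≡ 0ℚ + c * 0ℚ
    padding = solve-∀ ℚ-ring

  support-⊆ : ∀ {P Q Φ} → (∀ {n} → P n → Q n) → IsLinear P Φ → IsLinear Q Φ
  support-⊆ P⊆Q Φ-linear = record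
    { cong-on = λ F≗G → cong-on (λ n Pn → F≗G n (P⊆Q Pn))
    ; linear  = linear
    }
    where open IsLinear Φ-linear

  compose : ∀ {m Φ} (O : (ℕ → ℚ) → ℕ → ℚ) → IsLinear (_∈[ m ,N⟩) Φ →
    (∀ n → n < N → IsLinear (_∈[ n ,N⟩) (λ F → O F n)) →
    IsLinear (_∈[ m ,N⟩) (λ F → Φ (O F))
  compose O Φ-linear O-linear = record
    { cong-on = λ F≗G → Φ.cong-on (λ n m≤n<N → O.cong-on n (proj₂ m≤n<N) (λ j n≤j<N →
                  F≗G j (ℕₚ.≤-trans (proj₁ m≤n<N) (proj₁ n≤j<N) , proj₂ n≤j<N)))
    ; linear  = λ F c G → trans (Φ.cong-on (λ n m≤n<N → O.linear n (proj₂ m≤n<N) F c G))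
                                (Φ.linear _ c _)
    }
    where
    module Φ = IsLinear Φ-linear
    module O n (n<N : n < N) = IsLinear (O-linear n n<N)

  L^-linear : ∀ c {m} → m < N → IsLinear (_∈[ m ,N⟩) (λ F → L^ c F m)
  L^-linear zero    m<N = evaluation-linear m<N
  L^-linear (suc c) m<N = compose L (L^-linear c m<N) (λ n _ → L-linear n)

  mutual
    Iᴷ-linear : ∀ ks xs {m} → m < N → IsLinear (_∈[ m ,N⟩) (λ K → Iᴷ K ks xs m)
    Iᴷ-linear []       xs       m<N = evaluation-linear m<N
    Iᴷ-linear (k ∷ ks) []       _   = zero-linear
    Iᴷ-linear (k ∷ ks) (x ∷ xs) _   =
      support-⊆ (λ m<n<N → ℕₚ.<⇒≤ (proj₁ m<n<N) , proj₂ m<n<N) (Iᴷ-linear-strict k ks x xs)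

    Iᴷ-linear-strict : ∀ k ks x xs {m} →
      IsLinear (_∈[ suc m ,N⟩) (λ K → Iᴷ K (k ∷ ks) (x ∷ xs) m)
    Iᴷ-linear-strict k ks x xs {m} = compose (λ K → L^ (k ∸ 1) (Iᴷ K ks xs)) (A-linear x m)
      (λ n n<N → compose (λ K → Iᴷ K ks xs) (L^-linear (k ∸ 1) n<N)
        (λ j j<N → Iᴷ-linear ks xs j<N))

  L^-comm : ∀ c F n → L^ c (L F) n ≡ L (L^ c F) n
  L^-comm zero    F n = refl
  L^-comm (suc c) F n = L^-comm c (L F) n

  mutual
    I-as-Iᴷ : ∀ m ks xs → Iafter N m ks xs ≡ Iᴷ 𝟏 ks xs m
    I-as-Iᴷ m []       xs       = refl
    I-as-Iᴷ m (k ∷ ks) []       = refl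
    I-as-Iᴷ m (k ∷ ks) (x ∷ xs) =
      IsLinear.cong-on (A-linear x m) (λ n _ → chain-as-L^ (k ∸ 1) n ks xs)

    chain-as-L^ : ∀ c n ks xs → chain N c n ks xs ≡ L^ c (Iᴷ 𝟏 ks xs) n
    chain-as-L^ zero    n ks xs = I-as-Iᴷ n ks xs
    chain-as-L^ (suc c) n ks xs =
      trans (IsLinear.cong-on (L-linear n) (λ j _ → chain-as-L^ c j ks xs)) (sym (L^-comm c _ n))

  Iᴷ-++ : ∀ K a y ks xs → length a ≡ length y → ∀ m →
    Iᴷ K (a ++ ks) (y ++ xs) m ≡ Iᴷ (Iᴷ K ks xs) a y m
  Iᴷ-++ K []      []      ks xs _   m = refl
  Iᴷ-++ K (k ∷ a) (x ∷ y) ks xs a≍y m = IsLinear.cong-on (Iᴷ-linear-strict k [] x [] {m})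
    (λ n _ → Iᴷ-++ K a y ks xs (ℕₚ.suc-injective a≍y) n)

  -- A term I_ks(xs) of the theorem, or (zeroed) one of the terms that case (3) interprets as 0.
  -- ⟪ e ⟫ m is its tail with lower summation bound m; with-prefix a y puts the blocks (a, y) in front.
  record Expr : Set where
    constructor expr
    field
      zeroed  : Bool
      indices : List ℕ
      points  : List ℚ

  pattern I⟨_,_⟩ ks xs = expr false ks xs
  pattern 0⟨_,_⟩ ks xs = expr true ks xs

  continuation : Bool → ℕ → ℚ
  continuation false = 𝟏
  continuation true  = 𝟎

  ⟪_⟫ : Expr → ℕ → ℚ
  ⟪ e ⟫ = Iᴷ (continuation (Expr.zeroed e)) (Expr.indices e) (Expr.points e)

  _◃_ : ℕ × ℚ → Expr → Expr
  (k , x) ◃ e = expr (Expr.zeroed e) (k ∷ Expr.indices e) (x ∷ Expr.points e)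

  with-prefix : List ℕ → List ℚ → Expr → ℚ
  with-prefix a y I⟨ ks , xs ⟩ = I N (a ++ ks) (y ++ xs)
  with-prefix a y 0⟨ _  , _  ⟩ = 0ℚ

  record TailIdentity (ds es : List (ℚ × Expr × Expr)) : Set where
    constructor at-every-bound
    field
      holds : ∀ m → m < N →
        combination (λ e → ⟪ e ⟫ m) ds ≡ combination (λ e → ⟪ e ⟫ m) es

  with-prefix-as-Iᴷ : ∀ {a y} → length a ≡ length y → ∀ e →
    with-prefix a y e ≡ Iᴷ ⟪ e ⟫ a y 0
  with-prefix-as-Iᴷ {a} {y} a≍y I⟨ ks , xs ⟩ =
    trans (I-as-Iᴷ 0 (a ++ ks) (y ++ xs)) (Iᴷ-++ 𝟏 a y ks xs a≍y 0)
  with-prefix-as-Iᴷ {a} {y} a≍y 0⟨ ks , xs ⟩ = sym (begin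
    Iᴷ (Iᴷ 𝟎 ks xs) a y 0  ≡⟨ cong-on (λ n 0≤n<N → vanishes (proj₂ 0≤n<N)) ⟩
    Iᴷ 𝟎 a y 0             ≡⟨ zero-hom ⟩
    0ℚ                     ∎)
    where
    open IsLinear (Iᴷ-linear a y (s≤s z≤n))
    vanishes : ∀ {n} → n < N → Iᴷ 𝟎 ks xs n ≡ 0ℚ
    vanishes n<N = IsLinear.zero-hom (Iᴷ-linear ks xs n<N)

  prefix-extension : ∀ a y → length a ≡ length y → ∀ {ds es} → TailIdentity ds es →
    combination (with-prefix a y) ds ≡ combination (with-prefix a y) es
  prefix-extension a y a≍y {ds} {es} tails = begin
    combination (with-prefix a y) ds       ≡⟨ combination-cong (with-prefix-as-Iᴷ a≍y) ds ⟩
    combination (λ e → Iᴷ ⟪ e ⟫ a y 0) ds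
      ≡⟨ IsLinear.lift (Iᴷ-linear a y (s≤s z≤n)) ⟪_⟫ ds es
           (λ m 0≤m<N → TailIdentity.holds tails m (proj₂ 0≤m<N)) ⟩
    combination (λ e → Iᴷ ⟪ e ⟫ a y 0) es
      ≡⟨ combination-cong (with-prefix-as-Iᴷ a≍y) es ⟨
    combination (with-prefix a y) es       ∎

  NoPole : ℚ → Set
  NoPole x = ∀ n → 0 < n → n < N → ⟦ n ⟧ - 𝐍 * x ≢ 0ℚ

  𝐍≢0 : 𝐍 ≢ 0ℚ
  𝐍≢0 = ⟦suc⟧≢0 h

  𝐍ι : 𝐍 * ι ≡ 1ℚ
  𝐍ι = inv-inverseʳ 𝐍≢0

  no-pole-at-0 : ∀ {x} → x ≢ 0ℚ → ⟦ 0 ⟧ - 𝐍 * x ≢ 0ℚ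
  no-pole-at-0 {x} x≢0 pole = x≢0
    (by-combination ((- ι , ⟦ 0 ⟧ - 𝐍 * x , 0ℚ) ∷ (- x , 𝐍 * ι , 1ℚ) ∷ [])
      (certificate 𝐍 x ι) (pole ∷ 𝐍ι ∷ []))
    where
    certificate : ∀ 𝐍 x ι →
      x ≡ 0ℚ + ((- ι) * ((0ℚ - 𝐍 * x) - 0ℚ) + (- x) * (𝐍 * ι - 1ℚ))
    certificate = solve-∀ ℚ-ring

  no-pole-below-N : ∀ {x} → x ≢ 0ℚ → NoPole x → ∀ n → n < N → ⟦ n ⟧ - 𝐍 * x ≢ 0ℚ
  no-pole-below-N x≢0 x-regular zero    _   = no-pole-at-0 x≢0
  no-pole-below-N x≢0 x-regular (suc n) n<N = x-regular (suc n) (s≤s z≤n) n<N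

  g-shift : ∀ x n → g (x ⁺) (suc n) ≡ g x n
  g-shift x n = cong inv
    (by-combination {b = ⟦ n ⟧ - 𝐍 * x}
      ((1ℚ , ⟦ suc n ⟧ , ⟦ n ⟧ + 1ℚ) ∷ (- 1ℚ , 𝐍 * ι , 1ℚ) ∷ [])
      (certificate ⟦ suc n ⟧ ⟦ n ⟧ 𝐍 x ι) (⟦suc⟧ n ∷ 𝐍ι ∷ []))
    where
    certificate : ∀ a b 𝐍 x ι →
      a - 𝐍 * (x + ι) ≡ (b - 𝐍 * x) + (1ℚ * (a - (b + 1ℚ)) + (- 1ℚ) * (𝐍 * ι - 1ℚ))
    certificate = solve-∀ ℚ-ring

  inv-of-negated-𝐍-multiple : ∀ {X Y} → Y ≢ 0ℚ → X ≡ - (𝐍 * Y) → 𝐍 * inv X ≡ - inv Y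
  inv-of-negated-𝐍-multiple {X} {Y} Y≢0 X≡ = begin
    𝐍 * inv X          ≡⟨ cong (𝐍 *_) (inv-unique {a = X} inverse) ⟩
    𝐍 * - (ι * inv Y)  ≡⟨ by-combination ((- inv Y , 𝐍 * ι , 1ℚ) ∷ []) (cancel 𝐍 ι (inv Y))
                                           (𝐍ι ∷ []) ⟩
    - inv Y            ∎
    where
    cancel : ∀ 𝐍 ι y → 𝐍 * - (ι * y) ≡ - y + (- y) * (𝐍 * ι - 1ℚ)
    cancel = solve-∀ ℚ-ring
    certificate : ∀ X Y 𝐍 ι Y⁻¹ → X * - (ι * Y⁻¹) ≡ 1ℚ +
      (((- (ι * Y⁻¹)) * (X - - (𝐍 * Y)) + (Y⁻¹ * Y) * (𝐍 * ι - 1ℚ))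
        + 1ℚ * (Y * Y⁻¹ - 1ℚ))
    certificate = solve-∀ ℚ-ring
    inverse : X * - (ι * inv Y) ≡ 1ℚ
    inverse = by-combination
      ((- (ι * inv Y) , X , - (𝐍 * Y)) ∷ (inv Y * Y , 𝐍 * ι , 1ℚ) ∷
       (1ℚ , Y * inv Y , 1ℚ) ∷ [])
      (certificate X Y 𝐍 ι (inv Y)) (X≡ ∷ 𝐍ι ∷ inv-inverseʳ Y≢0 ∷ [])

  𝐍g-at-0 : ∀ {x} → x ≢ 0ℚ → 𝐍 * g x 0 ≡ - inv x
  𝐍g-at-0 {x} x≢0 = inv-of-negated-𝐍-multiple x≢0 (from-zero (𝐍 * x))
    where
    from-zero : ∀ a → 0ℚ - a ≡ - a
    from-zero = solve-∀ ℚ-ring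

  𝐍g-at-h : ∀ {x} → x ⁺ - 1ℚ ≢ 0ℚ → 𝐍 * g x h ≡ - inv (x ⁺ - 1ℚ)
  𝐍g-at-h {x} x⁺-1≢0 = inv-of-negated-𝐍-multiple x⁺-1≢0
    (by-combination ((- 1ℚ , 𝐍 , ⟦ h ⟧ + 1ℚ) ∷ (1ℚ , 𝐍 * ι , 1ℚ) ∷ [])
      (certificate ⟦ h ⟧ 𝐍 x ι) (⟦suc⟧ h ∷ 𝐍ι ∷ []))
    where
    certificate : ∀ a 𝐍 x ι → a - 𝐍 * x ≡ - (𝐍 * ((x + ι) - 1ℚ)) +
      ((- 1ℚ) * (𝐍 - (a + 1ℚ)) + 1ℚ * (𝐍 * ι - 1ℚ))
    certificate = solve-∀ ℚ-ring

  scaled-inv-difference : ∀ {X Y Z c} → X ≢ 0ℚ → Y ≢ 0ℚ → Z ≢ 0ℚ → Y - X ≡ c * Z →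
    inv Z * (inv X - inv Y) ≡ c * inv X * inv Y
  scaled-inv-difference {X} {Y} {Z} {c} X≢0 Y≢0 Z≢0 Y-X≡ = by-combination
    ((- (inv Z * inv X) , Y * inv Y , 1ℚ) ∷ (inv Z * inv Y , X * inv X , 1ℚ) ∷
     (inv X * inv Y * inv Z , Y - X , c * Z) ∷ (c * inv X * inv Y , Z * inv Z , 1ℚ) ∷ [])
    (certificate X Y Z c (inv X) (inv Y) (inv Z))
    (inv-inverseʳ Y≢0 ∷ inv-inverseʳ X≢0 ∷ Y-X≡ ∷ inv-inverseʳ Z≢0 ∷ [])
    where
    certificate : ∀ X Y Z c X⁻¹ Y⁻¹ Z⁻¹ → Z⁻¹ * (X⁻¹ - Y⁻¹) ≡ c * X⁻¹ * Y⁻¹ +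
      ((((- (Z⁻¹ * X⁻¹)) * (Y * Y⁻¹ - 1ℚ) + (Z⁻¹ * Y⁻¹) * (X * X⁻¹ - 1ℚ))
        + (X⁻¹ * Y⁻¹ * Z⁻¹) * ((Y - X) - c * Z)) + (c * X⁻¹ * Y⁻¹) * (Z * Z⁻¹ - 1ℚ))
    certificate = solve-∀ ℚ-ring

  g-minus-reciprocal : ∀ {v} n → v ≢ 0ℚ → ⟦ n ⟧ ≢ 0ℚ → ⟦ n ⟧ - 𝐍 * v ≢ 0ℚ →
    inv v * (g v n - inv ⟦ n ⟧) ≡ 𝐍 * g v n * inv ⟦ n ⟧
  g-minus-reciprocal {v} n v≢0 n≢0 pole =
    scaled-inv-difference {c = 𝐍} pole n≢0 v≢0 (gap ⟦ n ⟧ 𝐍 v)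
    where
    gap : ∀ n 𝐍 v → n - (n - 𝐍 * v) ≡ 𝐍 * v
    gap = solve-∀ ℚ-ring

  g-difference : ∀ {u v} n → ⟦ n ⟧ - 𝐍 * u ≢ 0ℚ → ⟦ n ⟧ - 𝐍 * v ≢ 0ℚ →
    v - u ≢ 0ℚ → inv (v - u) * (g v n - g u n) ≡ 𝐍 * g v n * g u n
  g-difference {u} {v} n u-pole v-pole v-u≢0 =
    scaled-inv-difference {c = 𝐍} v-pole u-pole v-u≢0 (gap ⟦ n ⟧ 𝐍 u v)
    where
    gap : ∀ n 𝐍 u v → (n - 𝐍 * u) - (n - 𝐍 * v) ≡ 𝐍 * (v - u)
    gap = solve-∀ ℚ-ring

  g-difference-shifted : ∀ {x w} n → ⟦ n ⟧ - 𝐍 * x ≢ 0ℚ → ⟦ suc n ⟧ - 𝐍 * w ≢ 0ℚ →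
    x ⁺ - w ≢ 0ℚ → inv (x ⁺ - w) * (g x n - g w (suc n)) ≡ 𝐍 * g x n * g w (suc n)
  g-difference-shifted {x} {w} n x-pole w-pole x⁺-w≢0 =
    scaled-inv-difference {c = 𝐍} x-pole w-pole x⁺-w≢0
    (by-combination ((1ℚ , ⟦ suc n ⟧ , ⟦ n ⟧ + 1ℚ) ∷ (- 1ℚ , 𝐍 * ι , 1ℚ) ∷ [])
      (certificate ⟦ suc n ⟧ ⟦ n ⟧ 𝐍 x w ι) (⟦suc⟧ n ∷ 𝐍ι ∷ []))
    where
    certificate : ∀ a b 𝐍 x w ι → (a - 𝐍 * w) - (b - 𝐍 * x) ≡ 𝐍 * ((x + ι) - w) +
      (1ℚ * (a - (b + 1ℚ)) + (- 1ℚ) * (𝐍 * ι - 1ℚ))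
    certificate = solve-∀ ℚ-ring

  A-shift : ∀ x F m → A (x ⁺) F m ≡ Σ[ m , h ⟩ (x ⊙ (F ∘ suc))
  A-shift x F m = Σ-cong m h (λ j _ _ → cong (_* F (suc j)) (g-shift x j))

  A-shift-closed : ∀ x F {m} → m < N → F N ≡ 0ℚ → Σ[ m , N ⟩ (x ⊙ (F ∘ suc)) ≡ A (x ⁺) F m
  A-shift-closed x F {m} m<N F-vanishes = begin
    Σ[ m , N ⟩ (x ⊙ (F ∘ suc))   ≡⟨ Σ-last m h (x ⊙ (F ∘ suc)) (ℕₚ.≤-pred m<N) ⟩
    T + g x h * F N              ≡⟨ cong (λ t → T + g x h * t) F-vanishes ⟩
    T + g x h * 0ℚ               ≡⟨ drop T (g x h) ⟩
    T                            ≡⟨ A-shift x F m ⟨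
    A (x ⁺) F m                  ∎
    where
    T = Σ[ m , h ⟩ (x ⊙ (F ∘ suc))
    drop : ∀ a b → a + b * 0ℚ ≡ a
    drop = solve-∀ ℚ-ring

  A-shift-first : ∀ x F {m} → m < N → F N ≡ 0ℚ →
    A (x ⁺) F m ≡ g x m * F (suc m) + Σ[ suc m , N ⟩ (x ⊙ (F ∘ suc))
  A-shift-first x F {m} m<N F-vanishes =
    trans (sym (A-shift-closed x F m<N F-vanishes)) (Σ-first m N (x ⊙ (F ∘ suc)) m<N)

  S-first : ∀ x F {m} → m < N → S x F m ≡ g x m * F m + A x F m
  S-first x F {m} = Σ-first m N (x ⊙ F)

  L-first : ∀ D {m} → m < N → L D m ≡ inv ⟦ m ⟧ * D m + L D (suc m)
  L-first D {m} = Σ-first m N (D /ℕ)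

  L-vanishes : ∀ D → L D N ≡ 0ℚ
  L-vanishes D = Σ-empty N N (D /ℕ) ℕₚ.≤-refl

  A-vanishes : ∀ x F → A x F h ≡ 0ℚ
  A-vanishes x F = Σ-empty N N (x ⊙ F) ℕₚ.≤-refl

  L-step : ∀ {F D : ℕ → ℚ} → (∀ n → F n ≡ L D n) → ∀ {m} → m < N →
    F m ≡ inv ⟦ m ⟧ * D m + F (suc m)
  L-step {F} {D} F≗LD {m} m<N =
    trans (F≗LD m) (trans (L-first D m<N) (cong (inv ⟦ m ⟧ * D m +_) (sym (F≗LD (suc m)))))

  A-of-L : ∀ x {F D : ℕ → ℚ} → (∀ n → F n ≡ L D n) → ∀ m →
    A x F m ≡ Σ[ suc m , N ⟩ (x ⊙ (D /ℕ)) + 1ℚ * Σ[ suc m , N ⟩ (x ⊙ (F ∘ suc))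
  A-of-L x {F} {D} F≗LD m = trans
    (Σ-cong (suc m) N (λ j _ j<N →
      split (g x j) (inv ⟦ j ⟧ * D j) (F (suc j)) (L-step {F} {D} F≗LD j<N)))
    (Σ-linear (suc m) N (x ⊙ (D /ℕ)) 1ℚ (x ⊙ (F ∘ suc)))
    where
    distrib : ∀ g iD F′ → g * (iD + F′) ≡ g * iD + 1ℚ * (g * F′)
    distrib = solve-∀ ℚ-ring
    split : ∀ g iD F′ {F} → F ≡ iD + F′ → g * F ≡ g * iD + 1ℚ * (g * F′)
    split g iD F′ refl = distrib g iD F′

  Σ-g-reciprocal : ∀ {v} D → v ≢ 0ℚ → NoPole v → ∀ m →
    𝐍 * Σ[ suc m , N ⟩ (v ⊙ (D /ℕ)) ≡ inv v * (A v D m - L D (suc m))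
  Σ-g-reciprocal {v} D v≢0 v-regular m = begin
    𝐍 * Σ[ suc m , N ⟩ (v ⊙ (D /ℕ))                         ≡⟨ scale 𝐍 (v ⊙ (D /ℕ)) ⟨
    Σ[ suc m , N ⟩ (λ j → 𝐍 * (v ⊙ (D /ℕ)) j)               ≡⟨ cong-on pointwise ⟩
    Σ[ suc m , N ⟩ (λ j → inv v * ((v ⊙ D) j - (D /ℕ) j))   ≡⟨ difference (inv v) (v ⊙ D) (D /ℕ) ⟩
    inv v * (A v D m - L D (suc m))                         ∎
    where
    open IsLinear (Σ-is-linear (suc m) N)
    certificate : ∀ 𝐍 g i D v⁻¹ → 𝐍 * (g * (i * D)) ≡ v⁻¹ * (g * D - i * D) +
      (- D) * (v⁻¹ * (g - i) - 𝐍 * g * i)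
    certificate = solve-∀ ℚ-ring
    pointwise : ∀ j → j ∈[ suc m ,N⟩ → 𝐍 * (v ⊙ (D /ℕ)) j ≡ inv v * ((v ⊙ D) j - (D /ℕ) j)
    pointwise (suc j) (_ , j<N) = by-combination
      ((- D (suc j) , inv v * (g v (suc j) - inv ⟦ suc j ⟧) ,
          𝐍 * g v (suc j) * inv ⟦ suc j ⟧) ∷ [])
      (certificate 𝐍 (g v (suc j)) (inv ⟦ suc j ⟧) (D (suc j)) (inv v))
      (g-minus-reciprocal (suc j) v≢0 (⟦suc⟧≢0 j) (v-regular (suc j) (s≤s z≤n) j<N) ∷ [])

  -- The block of v when k_i > 1: its inner sums are F = L D.
  module _ {v : ℚ} {F D : ℕ → ℚ} (F≗LD : ∀ n → F n ≡ L D n) (v≢0 : v ≢ 0ℚ) (v-regular : NoPole v)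
           where

    private
      F-vanishes : F N ≡ 0ℚ
      F-vanishes = trans (F≗LD N) (L-vanishes D)

    Δ-long : ∀ m → m < N →
      𝐍 * (A (v ⁺) F m - A v F m) ≡ 𝐍 * g v m * F (suc m) + inv v * (F (suc m) - A v D m)
    Δ-long m m<N = by-combination
      ((𝐍 , A (v ⁺) F m , g v m * F (suc m) + X) ∷ (- 𝐍 , A v F m , Y + 1ℚ * X) ∷
       (- 1ℚ , 𝐍 * Y , inv v * (A v D m - L D (suc m))) ∷ (- inv v , F (suc m) , L D (suc m)) ∷ [])
      (certificate 𝐍 (A (v ⁺) F m) (A v F m) (g v m) (F (suc m)) X Y (inv v) (A v D m) (L D (suc m)))
      (A-shift-first v F m<N F-vanishes ∷ A-of-L v {F} {D} F≗LD m ∷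
       Σ-g-reciprocal D v≢0 v-regular m ∷ F≗LD (suc m) ∷ [])
      where
      X = Σ[ suc m , N ⟩ (v ⊙ (F ∘ suc))
      Y = Σ[ suc m , N ⟩ (v ⊙ (D /ℕ))
      certificate : ∀ 𝐍 A⁺ A g F′ X Y v⁻¹ AD LD′ →
        𝐍 * (A⁺ - A) ≡ (𝐍 * g * F′ + v⁻¹ * (F′ - AD)) +
          (((𝐍 * (A⁺ - (g * F′ + X)) + (- 𝐍) * (A - (Y + 1ℚ * X)))
            + (- 1ℚ) * (𝐍 * Y - v⁻¹ * (AD - LD′))) + (- v⁻¹) * (F′ - LD′))
      certificate = solve-∀ ℚ-ring

    Δ-long′ : ∀ m → 0 < m → m < N →
      𝐍 * (A (v ⁺) F m - A v F m) ≡ 𝐍 * g v m * F m + inv v * (F m - A v D m) - inv v * g v m * D m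
    Δ-long′ (suc m) _ m<N = by-combination
      ((1ℚ , 𝐍 * (A (v ⁺) F (suc m) - A v F (suc m)) , 𝐍 * g′ * F″ + inv v * (F″ - AD)) ∷
       (- (𝐍 * g′ + inv v) , F (suc m) , i * D (suc m) + F″) ∷
       (D (suc m) , inv v * (g′ - i) , 𝐍 * g′ * i) ∷ [])
      (certificate 𝐍 (A (v ⁺) F (suc m)) (A v F (suc m)) g′ (F (suc m)) F″ (inv v) AD i (D (suc m)))
      (Δ-long (suc m) m<N ∷ L-step {F} {D} F≗LD m<N ∷
       g-minus-reciprocal (suc m) v≢0 (⟦suc⟧≢0 m) (v-regular (suc m) (s≤s z≤n) m<N) ∷ [])
      where
      AD = A v D (suc m)
      F″ = F (suc (suc m))
      g′ = g v (suc m)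
      i = inv ⟦ suc m ⟧
      certificate : ∀ 𝐍 A⁺ A g F F′ v⁻¹ AD i D →
        𝐍 * (A⁺ - A) ≡ 𝐍 * g * F + v⁻¹ * (F - AD) - v⁻¹ * g * D +
          ((1ℚ * (𝐍 * (A⁺ - A) - (𝐍 * g * F′ + v⁻¹ * (F′ - AD)))
            + (- (𝐍 * g + v⁻¹)) * (F - (i * D + F′))) + D * (v⁻¹ * (g - i) - 𝐍 * g * i))
      certificate = solve-∀ ℚ-ring

    reciprocal-Δ-long : ∀ j → 0 < j → j < N →
      𝐍 * ((A (v ⁺) F /ℕ) j - (A v F /ℕ) j) ≡ inv v * ((v ⊙ (F ∘ suc)) j - (A v D /ℕ) j)
    reciprocal-Δ-long (suc j) _ j<N = by-combination
      ((i , 𝐍 * (A (v ⁺) F (suc j) - A v F (suc j)) , 𝐍 * g′ * F″ + inv v * (F″ - AD)) ∷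
       (- F″ , inv v * (g′ - i) , 𝐍 * g′ * i) ∷ [])
      (certificate 𝐍 i (A (v ⁺) F (suc j)) (A v F (suc j)) g′ F″ (inv v) AD)
      (Δ-long (suc j) j<N ∷
       g-minus-reciprocal (suc j) v≢0 (⟦suc⟧≢0 j) (v-regular (suc j) (s≤s z≤n) j<N) ∷ [])
      where
      AD = A v D (suc j)
      F″ = F (suc (suc j))
      g′ = g v (suc j)
      i = inv ⟦ suc j ⟧
      certificate : ∀ 𝐍 i A⁺ A g F′ v⁻¹ AD →
        𝐍 * (i * A⁺ - i * A) ≡ v⁻¹ * (g * F′ - i * AD) +
          (i * (𝐍 * (A⁺ - A) - (𝐍 * g * F′ + v⁻¹ * (F′ - AD)))
            + (- F′) * (v⁻¹ * (g - i) - 𝐍 * g * i))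
      certificate = solve-∀ ℚ-ring

    L-Δ-long : ∀ m → 0 < m → m < N →
      𝐍 * (L (A (v ⁺) F) m - L (A v F) m) ≡ inv v * (A (v ⁺) F m - L (A v D) m)
    L-Δ-long m 0<m m<N = begin
      𝐍 * (L (A (v ⁺) F) m - L (A v F) m)
        ≡⟨ IsLinear.lift (Σ-is-linear m N) id
             ((𝐍 , A (v ⁺) F /ℕ , A v F /ℕ) ∷ [])
             ((inv v , v ⊙ (F ∘ suc) , A v D /ℕ) ∷ [])
             (λ j m≤j<N → reciprocal-Δ-long j (ℕₚ.<-≤-trans 0<m (proj₁ m≤j<N)) (proj₂ m≤j<N)) ⟩
      inv v * (Σ[ m , N ⟩ (v ⊙ (F ∘ suc)) - L (A v D) m)
        ≡⟨ cong (λ t → inv v * (t - L (A v D) m)) (A-shift-closed v F m<N F-vanishes) ⟩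
      inv v * (A (v ⁺) F m - L (A v D) m) ∎

    weighted-Δ-long : ∀ {u} → NoPole u → v - u ≢ 0ℚ → ∀ n → 0 < n → n < N →
      𝐍 * ((u ⊙ A (v ⁺) F) n - (u ⊙ A v F) n)
        ≡ inv (v - u) * ((v ⊙ F) n - (u ⊙ F) n) + inv v * ((u ⊙ F) n - (u ⊙ A v D) n)
          + ι * inv (v * (v - u)) * ((u ⊙ D) n - (v ⊙ D) n)
    weighted-Δ-long {u} u-regular v-u≢0 n 0<n n<N = by-combination
      ((g u n , 𝐍 * (A (v ⁺) F n - A v F n) ,
          𝐍 * g v n * F n + inv v * (F n - A v D n) - inv v * g v n * D n) ∷
       (ι * inv v * D n - F n , inv (v - u) * (g v n - g u n) , 𝐍 * g v n * g u n) ∷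
       (- (ι * (g u n - g v n) * D n) , inv (v * (v - u)) , inv v * inv (v - u)) ∷
       (inv v * g u n * g v n * D n , 𝐍 * ι , 1ℚ) ∷ [])
      (certificate 𝐍 (g u n) (g v n) (A (v ⁺) F n) (A v F n) (F n) (D n) (A v D n) (inv v)
        (inv (v - u)) (inv (v * (v - u))) ι)
      (Δ-long′ n 0<n n<N ∷ g-difference n (u-regular n 0<n n<N) (v-regular n 0<n n<N) v-u≢0 ∷
       inv-* v≢0 v-u≢0 ∷ 𝐍ι ∷ [])
      where
      certificate : ∀ 𝐍 gu gv A⁺ A F D AD v⁻¹ vu⁻¹ vvu⁻¹ ι →
        𝐍 * (gu * A⁺ - gu * A)
          ≡ vu⁻¹ * (gv * F - gu * F) + v⁻¹ * (gu * F - gu * AD) + ι * vvu⁻¹ * (gu * D - gv * D) +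
            ((((gu * (𝐍 * (A⁺ - A) - (𝐍 * gv * F + v⁻¹ * (F - AD) - v⁻¹ * gv * D)))
              + (ι * v⁻¹ * D - F) * (vu⁻¹ * (gv - gu) - 𝐍 * gv * gu))
              + (- (ι * (gu - gv) * D)) * (vvu⁻¹ - v⁻¹ * vu⁻¹))
              + (v⁻¹ * gu * gv * D) * (𝐍 * ι - 1ℚ))
      certificate = solve-∀ ℚ-ring

    first-block-long : 𝐍 * (A (v ⁺) F 0 - A v F 0) ≡ - (inv v * A v D 0)
    first-block-long = trans (Δ-long 0 (s≤s z≤n))
      (by-combination ((F 1 , 𝐍 * g v 0 , - inv v) ∷ [])
        (certificate (𝐍 * g v 0) (F 1) (inv v) (A v D 0)) (𝐍g-at-0 v≢0 ∷ []))
      where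
      certificate : ∀ a F₁ v⁻¹ AD →
        a * F₁ + v⁻¹ * (F₁ - AD) ≡ - (v⁻¹ * AD) + F₁ * (a - - v⁻¹)
      certificate = solve-∀ ℚ-ring

  -- What follows the block of x_i: further blocks, or nothing when i = r.  x-after and shifted
  -- implement the conventions of case (3): x_{r+1} = 1, and I_{k_r^∧}(x_{r+1}^∧)|_{x_r + 1/N} = 0.
  data Rest : Set where
    next : ℕ → List ℕ → ℚ → List ℚ → Rest
    end  : Rest

  indices-after : Rest → List ℕ
  indices-after (next c b _ _) = c ∷ b
  indices-after end            = []

  points-after : Rest → List ℚ
  points-after (next _ _ w z) = w ∷ z
  points-after end            = []

  x-after : Rest → ℚ
  x-after (next _ _ w _) = w
  x-after end            = 1ℚ

  shifted : ℚ → Rest → Expr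
  shifted x (next c b _ z) = I⟨ c ∷ b , x ∷ z ⟩
  shifted x end            = 0⟨ [] , [] ⟩

  Admissible : Rest → Set
  Admissible (next _ _ w _) = NoPole w
  Admissible end            = ⊤

  R : Rest → ℕ → ℚ
  R ρ = ⟪ I⟨ indices-after ρ , points-after ρ ⟩ ⟫

  R⁺ : ℚ → Rest → ℕ → ℚ
  R⁺ v ρ = ⟪ shifted (v ⁺) ρ ⟫

  closed-minus-shifted-next : ∀ {v w} E → v ≢ 0ℚ → NoPole v → NoPole w → v ⁺ - w ≢ 0ℚ → ∀ m → m < N →
    S v (A w E) m - A (v ⁺) (A w E) m ≡ ι * inv (v ⁺ - w) * (A (v ⁺) E m - A w E m)
  closed-minus-shifted-next {v} {w} E v≢0 v-regular w-regular v⁺-w≢0 m m<N = begin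
    S v C m - A (v ⁺) C m
      ≡⟨ cong₂ _-_ closed (A-shift v C m) ⟩
    (Σ[ m , h ⟩ (v ⊙ C) + g v h * 0ℚ) - Σ[ m , h ⟩ (v ⊙ (C ∘ suc))
      ≡⟨ drop (Σ[ m , h ⟩ (v ⊙ C)) (g v h) (Σ[ m , h ⟩ (v ⊙ (C ∘ suc))) ⟩
    1ℚ * (Σ[ m , h ⟩ (v ⊙ C) - Σ[ m , h ⟩ (v ⊙ (C ∘ suc)))
      ≡⟨ IsLinear.lift (Σ-is-linear m h) id
           ((1ℚ , v ⊙ C , v ⊙ (C ∘ suc)) ∷ [])
           ((ι * inv (v ⁺ - w) , v ⊙ (E ∘ suc) , (w ⊙ E) ∘ suc) ∷ [])
           pointwise ⟩
    ι * inv (v ⁺ - w) * (Σ[ m , h ⟩ (v ⊙ (E ∘ suc)) - A w E m)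
      ≡⟨ cong (λ t → ι * inv (v ⁺ - w) * (t - A w E m)) (A-shift v E m) ⟨
    ι * inv (v ⁺ - w) * (A (v ⁺) E m - A w E m) ∎
    where
    C = A w E
    closed : S v C m ≡ Σ[ m , h ⟩ (v ⊙ C) + g v h * 0ℚ
    closed = trans (Σ-last m h (v ⊙ C) (ℕₚ.≤-pred m<N))
                   (cong (λ t → Σ[ m , h ⟩ (v ⊙ C) + g v h * t) (A-vanishes w E))
    drop : ∀ a b c → (a + b * 0ℚ) - c ≡ 1ℚ * (a - c)
    drop = solve-∀ ℚ-ring
    certificate : ∀ gv gw C C′ E′ i ι 𝐍 →
      1ℚ * (gv * C - gv * C′) ≡ ι * i * (gv * E′ - gw * E′) +
        ((gv * (C - (gw * E′ + C′)) + (- (ι * E′)) * (i * (gv - gw) - 𝐍 * gv * gw))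
          + (- (gv * gw * E′)) * (𝐍 * ι - 1ℚ))
    certificate = solve-∀ ℚ-ring
    pointwise : ∀ j → m ≤ j × j < h → 1ℚ * ((v ⊙ C) j - (v ⊙ (C ∘ suc)) j)
      ≡ ι * inv (v ⁺ - w) * ((v ⊙ (E ∘ suc)) j - (w ⊙ E) (suc j))
    pointwise j (_ , j<h) = by-combination
      ((g v j , C j , g w (suc j) * E (suc j) + C (suc j)) ∷
       (- (ι * E (suc j)) , inv (v ⁺ - w) * (g v j - g w (suc j)) , 𝐍 * g v j * g w (suc j)) ∷
       (- (g v j * g w (suc j) * E (suc j)) , 𝐍 * ι , 1ℚ) ∷ [])
      (certificate (g v j) (g w (suc j)) (C j) (C (suc j)) (E (suc j)) (inv (v ⁺ - w)) ι 𝐍)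
      (Σ-first (suc j) N (w ⊙ E) (s≤s j<h) ∷
       g-difference-shifted j (no-pole-below-N v≢0 v-regular j (ℕₚ.≤-trans j<h (ℕₚ.n≤1+n h)))
         (w-regular (suc j) (s≤s z≤n) (s≤s j<h)) v⁺-w≢0 ∷
       𝐍ι ∷ [])

  closed-minus-shifted-end : ∀ {v} → v ⁺ - 1ℚ ≢ 0ℚ → ∀ m → m < N →
    S v 𝟏 m - A (v ⁺) 𝟏 m ≡ ι * inv (v ⁺ - 1ℚ) * (0ℚ - 1ℚ)
  closed-minus-shifted-end {v} v⁺-1≢0 m m<N = begin
    S v 𝟏 m - A (v ⁺) 𝟏 m
      ≡⟨ cong₂ _-_ (Σ-last m h (v ⊙ 𝟏) (ℕₚ.≤-pred m<N)) (A-shift v 𝟏 m) ⟩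
    (Σ[ m , h ⟩ (v ⊙ 𝟏) + g v h * 1ℚ) - Σ[ m , h ⟩ (v ⊙ 𝟏)
      ≡⟨ by-combination ((ι , 𝐍 * g v h , - inv (v ⁺ - 1ℚ)) ∷ (- g v h , 𝐍 * ι , 1ℚ) ∷ [])
           (certificate (Σ[ m , h ⟩ (v ⊙ 𝟏)) (g v h) (inv (v ⁺ - 1ℚ)) ι 𝐍)
           (𝐍g-at-h v⁺-1≢0 ∷ 𝐍ι ∷ []) ⟩
    ι * inv (v ⁺ - 1ℚ) * (0ℚ - 1ℚ) ∎
    where
    certificate : ∀ T g i ι 𝐍 → (T + g * 1ℚ) - T ≡ ι * i * (0ℚ - 1ℚ) +
      (ι * (𝐍 * g - (- i)) + (- g) * (𝐍 * ι - 1ℚ))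
    certificate = solve-∀ ℚ-ring

  closed-minus-shifted : ∀ {v} ρ → v ≢ 0ℚ → NoPole v → Admissible ρ → v ⁺ - x-after ρ ≢ 0ℚ →
    ∀ m → m < N →
    S v (R ρ) m - A (v ⁺) (R ρ) m ≡ ι * inv (v ⁺ - x-after ρ) * (R⁺ v ρ m - R ρ m)
  closed-minus-shifted (next c b w z) v≢0 v-regular w-regular =
    closed-minus-shifted-next (L^ (c ∸ 1) (Iᴷ 𝟏 b z)) v≢0 v-regular w-regular
  closed-minus-shifted end _ _ _ = closed-minus-shifted-end

  -- The block of v when k_i = 1: its inner sums are those of the rest ρ.
  module _ {v : ℚ} (ρ : Rest) (v≢0 : v ≢ 0ℚ) (v-regular : NoPole v) (ρ-admissible : Admissible ρ)
           (v⁺-next≢0 : v ⁺ - x-after ρ ≢ 0ℚ) where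

    Δ-singleton : ∀ m → m < N →
      𝐍 * (A (v ⁺) (R ρ) m - A v (R ρ) m)
        ≡ 𝐍 * g v m * R ρ m + inv (v ⁺ - x-after ρ) * (R ρ m - R⁺ v ρ m)
    Δ-singleton m m<N = by-combination
      ((- 𝐍 , S v (R ρ) m - A (v ⁺) (R ρ) m , ι * i * (R⁺ v ρ m - R ρ m)) ∷
       (𝐍 , S v (R ρ) m , g v m * R ρ m + A v (R ρ) m) ∷
       (- (i * (R⁺ v ρ m - R ρ m)) , 𝐍 * ι , 1ℚ) ∷ [])
      (certificate 𝐍 (A (v ⁺) (R ρ) m) (A v (R ρ) m) (S v (R ρ) m) (g v m) (R ρ m) (R⁺ v ρ m)
        i ι)
      (closed-minus-shifted ρ v≢0 v-regular ρ-admissible v⁺-next≢0 m m<N ∷ S-first v (R ρ) m<N ∷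
       𝐍ι ∷ [])
      where
      i = inv (v ⁺ - x-after ρ)
      certificate : ∀ 𝐍 A⁺ A S g R R⁺ i ι →
        𝐍 * (A⁺ - A) ≡ 𝐍 * g * R + i * (R - R⁺) +
          (((- 𝐍) * ((S - A⁺) - ι * i * (R⁺ - R)) + 𝐍 * (S - (g * R + A)))
            + (- (i * (R⁺ - R))) * (𝐍 * ι - 1ℚ))
      certificate = solve-∀ ℚ-ring

    reciprocal-Δ-singleton : ∀ j → 0 < j → j < N →
      𝐍 * ((A (v ⁺) (R ρ) /ℕ) j - (A v (R ρ) /ℕ) j)
        ≡ inv v * ((v ⊙ R ρ) j - (R ρ /ℕ) j)
          + inv (v ⁺ - x-after ρ) * ((R ρ /ℕ) j - (R⁺ v ρ /ℕ) j)
    reciprocal-Δ-singleton (suc j) _ j<N = by-combination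
      ((i , 𝐍 * (A (v ⁺) (R ρ) (suc j) - A v (R ρ) (suc j)) ,
          𝐍 * g′ * R′ + i′ * (R′ - R⁺′)) ∷
       (- R′ , inv v * (g′ - i) , 𝐍 * g′ * i) ∷ [])
      (certificate 𝐍 i (A (v ⁺) (R ρ) (suc j)) (A v (R ρ) (suc j)) g′ R′ R⁺′ i′ (inv v))
      (Δ-singleton (suc j) j<N ∷
       g-minus-reciprocal (suc j) v≢0 (⟦suc⟧≢0 j) (v-regular (suc j) (s≤s z≤n) j<N) ∷ [])
      where
      R′ = R ρ (suc j)
      R⁺′ = R⁺ v ρ (suc j)
      g′ = g v (suc j)
      i = inv ⟦ suc j ⟧
      i′ = inv (v ⁺ - x-after ρ)
      certificate : ∀ 𝐍 i A⁺ A g R R⁺ i′ v⁻¹ →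
        𝐍 * (i * A⁺ - i * A) ≡ v⁻¹ * (g * R - i * R) + i′ * (i * R - i * R⁺) +
          (i * (𝐍 * (A⁺ - A) - (𝐍 * g * R + i′ * (R - R⁺)))
            + (- R) * (v⁻¹ * (g - i) - 𝐍 * g * i))
      certificate = solve-∀ ℚ-ring

    L-Δ-singleton : ∀ m → 0 < m → m < N →
      𝐍 * (L (A (v ⁺) (R ρ)) m - L (A v (R ρ)) m)
        ≡ inv v * (A (v ⁺) (R ρ) m - L (R ρ) m)
          + inv (v ⁺ - x-after ρ) * (L (R ρ) m - L (R⁺ v ρ) m)
          + ι * inv (v * (v ⁺ - x-after ρ)) * (R⁺ v ρ m - R ρ m)
    L-Δ-singleton m 0<m m<N = begin
      𝐍 * (L (A (v ⁺) (R ρ)) m - L (A v (R ρ)) m)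
        ≡⟨ IsLinear.lift (Σ-is-linear m N) id
             ((𝐍 , A (v ⁺) (R ρ) /ℕ , A v (R ρ) /ℕ) ∷ [])
             ((inv v , v ⊙ R ρ , R ρ /ℕ) ∷ (i , R ρ /ℕ , R⁺ v ρ /ℕ) ∷ [])
             (λ j m≤j<N → reciprocal-Δ-singleton j (ℕₚ.<-≤-trans 0<m (proj₁ m≤j<N))
                                                     (proj₂ m≤j<N)) ⟩
      inv v * (S v (R ρ) m - L (R ρ) m) + i * (L (R ρ) m - L (R⁺ v ρ) m)
        ≡⟨ by-combination
             ((inv v , S v (R ρ) m - A (v ⁺) (R ρ) m , ι * i * (R⁺ v ρ m - R ρ m)) ∷
              (- (ι * (R⁺ v ρ m - R ρ m)) , inv (v * (v ⁺ - x-after ρ)) , inv v * i) ∷ [])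
             (certificate (inv v) (S v (R ρ) m) (L (R ρ) m) (L (R⁺ v ρ) m) i (A (v ⁺) (R ρ) m) ι
               (R⁺ v ρ m) (R ρ m) (inv (v * (v ⁺ - x-after ρ))))
             (closed-minus-shifted ρ v≢0 v-regular ρ-admissible v⁺-next≢0 m m<N ∷
              inv-* v≢0 v⁺-next≢0 ∷ []) ⟩
      inv v * (A (v ⁺) (R ρ) m - L (R ρ) m) + i * (L (R ρ) m - L (R⁺ v ρ) m)
        + ι * inv (v * (v ⁺ - x-after ρ)) * (R⁺ v ρ m - R ρ m) ∎
      where
      i = inv (v ⁺ - x-after ρ)
      certificate : ∀ v⁻¹ S L L⁺ i A⁺ ι R⁺ R vw⁻¹ →
        v⁻¹ * (S - L) + i * (L - L⁺) ≡
          v⁻¹ * (A⁺ - L) + i * (L - L⁺) + ι * vw⁻¹ * (R⁺ - R) +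
          (v⁻¹ * ((S - A⁺) - ι * i * (R⁺ - R)) + (- (ι * (R⁺ - R))) * (vw⁻¹ - v⁻¹ * i))
      certificate = solve-∀ ℚ-ring

    weighted-Δ-singleton : ∀ {u} → NoPole u → v - u ≢ 0ℚ → ∀ n → 0 < n → n < N →
      𝐍 * ((u ⊙ A (v ⁺) (R ρ)) n - (u ⊙ A v (R ρ)) n)
        ≡ inv (v - u) * ((v ⊙ R ρ) n - (u ⊙ R ρ) n)
          + inv (v ⁺ - x-after ρ) * ((u ⊙ R ρ) n - (u ⊙ R⁺ v ρ) n)
    weighted-Δ-singleton {u} u-regular v-u≢0 n 0<n n<N = by-combination
      ((g u n , 𝐍 * (A (v ⁺) (R ρ) n - A v (R ρ) n) ,
          𝐍 * g v n * R ρ n + i * (R ρ n - R⁺ v ρ n)) ∷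
       (- R ρ n , inv (v - u) * (g v n - g u n) , 𝐍 * g v n * g u n) ∷ [])
      (certificate 𝐍 (g u n) (g v n) (A (v ⁺) (R ρ) n) (A v (R ρ) n) (R ρ n) (R⁺ v ρ n)
        (inv (v - u)) i)
      (Δ-singleton n n<N ∷ g-difference n (u-regular n 0<n n<N) (v-regular n 0<n n<N) v-u≢0 ∷ [])
      where
      i = inv (v ⁺ - x-after ρ)
      certificate : ∀ 𝐍 gu gv A⁺ A R R⁺ vu⁻¹ i →
        𝐍 * (gu * A⁺ - gu * A) ≡ vu⁻¹ * (gv * R - gu * R) + i * (gu * R - gu * R⁺) +
          ((gu * (𝐍 * (A⁺ - A) - (𝐍 * gv * R + i * (R - R⁺))))
            + (- R) * (vu⁻¹ * (gv - gu) - 𝐍 * gv * gu))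
      certificate = solve-∀ ℚ-ring

    first-block-singleton : 𝐍 * (A (v ⁺) (R ρ) 0 - A v (R ρ) 0)
      ≡ - (inv v * R ρ 0) + inv (v ⁺ - x-after ρ) * (R ρ 0 - R⁺ v ρ 0)
    first-block-singleton = trans (Δ-singleton 0 (s≤s z≤n))
      (by-combination ((R ρ 0 , 𝐍 * g v 0 , - inv v) ∷ [])
        (certificate (𝐍 * g v 0) (R ρ 0) (inv v) (inv (v ⁺ - x-after ρ)) (R⁺ v ρ 0))
        (𝐍g-at-0 v≢0 ∷ []))
      where
      certificate : ∀ a R₀ v⁻¹ i R⁺₀ →
        a * R₀ + i * (R₀ - R⁺₀) ≡ - (v⁻¹ * R₀) + i * (R₀ - R⁺₀) + R₀ * (a - - v⁻¹)
      certificate = solve-∀ ℚ-ring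

  -- Cases (2a)-(2d), and with ρ = end cases (3a)-(3d), for the blocks from x_{i-1} on, at every lower
  -- summation bound.
  tail-2a : ∀ pc qc ρ {u v} → v ≢ 0ℚ → NoPole v → TailIdentity
    ((𝐍 , I⟨ suc (suc pc) ∷ suc (suc qc) ∷ indices-after ρ , u ∷ v ⁺ ∷ points-after ρ ⟩ ,
          I⟨ suc (suc pc) ∷ suc (suc qc) ∷ indices-after ρ , u ∷ v ∷ points-after ρ ⟩) ∷ [])
    ((inv v , I⟨ suc pc ∷ suc (suc qc) ∷ indices-after ρ , u ∷ v ⁺ ∷ points-after ρ ⟩ ,
              I⟨ suc (suc pc) ∷ suc qc ∷ indices-after ρ , u ∷ v ∷ points-after ρ ⟩) ∷ [])
  tail-2a pc qc ρ {u} {v} v≢0 v-regular = at-every-bound λ lo _ →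
    IsLinear.lift (Iᴷ-linear-strict (suc pc) [] u [] {lo}) id
      ((𝐍 , L (A (v ⁺) F) , L (A v F)) ∷ []) ((inv v , A (v ⁺) F , L (A v D)) ∷ [])
      (λ m lo<m<N → L-Δ-long {D = D} (L^-comm qc (R ρ)) v≢0 v-regular m
         (ℕₚ.≤-trans (s≤s z≤n) (proj₁ lo<m<N)) (proj₂ lo<m<N))
    where
    F = L^ qc (L (R ρ))
    D = L^ qc (R ρ)

  tail-2b : ∀ pc ρ {u v} → v ≢ 0ℚ → NoPole v → Admissible ρ → v ⁺ - x-after ρ ≢ 0ℚ →
    TailIdentity
    ((𝐍 , I⟨ suc (suc pc) ∷ 1 ∷ indices-after ρ , u ∷ v ⁺ ∷ points-after ρ ⟩ ,
          I⟨ suc (suc pc) ∷ 1 ∷ indices-after ρ , u ∷ v ∷ points-after ρ ⟩) ∷ [])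
    ((inv v , I⟨ suc pc ∷ 1 ∷ indices-after ρ , u ∷ v ⁺ ∷ points-after ρ ⟩ ,
              I⟨ suc (suc pc) ∷ indices-after ρ , u ∷ points-after ρ ⟩) ∷
     (inv (v ⁺ - x-after ρ) , I⟨ suc (suc pc) ∷ indices-after ρ , u ∷ points-after ρ ⟩ ,
                              (suc (suc pc) , u) ◃ shifted (v ⁺) ρ) ∷
     (ι * inv (v * (v ⁺ - x-after ρ)) , (suc pc , u) ◃ shifted (v ⁺) ρ ,
                                        I⟨ suc pc ∷ indices-after ρ , u ∷ points-after ρ ⟩) ∷ [])
  tail-2b pc ρ {u} {v} v≢0 v-regular ρ-admissible v⁺-next≢0 = at-every-bound λ lo _ →
    IsLinear.lift (Iᴷ-linear-strict (suc pc) [] u [] {lo}) id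
      ((𝐍 , L (A (v ⁺) (R ρ)) , L (A v (R ρ))) ∷ [])
      ((inv v , A (v ⁺) (R ρ) , L (R ρ)) ∷ (inv (v ⁺ - x-after ρ) , L (R ρ) , L (R⁺ v ρ)) ∷
       (ι * inv (v * (v ⁺ - x-after ρ)) , R⁺ v ρ , R ρ) ∷ [])
      (λ m lo<m<N → L-Δ-singleton ρ v≢0 v-regular ρ-admissible v⁺-next≢0 m
         (ℕₚ.≤-trans (s≤s z≤n) (proj₁ lo<m<N)) (proj₂ lo<m<N))

  tail-2c : ∀ qc ρ {u v} → v ≢ 0ℚ → NoPole u → NoPole v → v - u ≢ 0ℚ → TailIdentity
    ((𝐍 , I⟨ 1 ∷ suc (suc qc) ∷ indices-after ρ , u ∷ v ⁺ ∷ points-after ρ ⟩ ,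
          I⟨ 1 ∷ suc (suc qc) ∷ indices-after ρ , u ∷ v ∷ points-after ρ ⟩) ∷ [])
    ((inv (v - u) , I⟨ suc (suc qc) ∷ indices-after ρ , v ∷ points-after ρ ⟩ ,
                    I⟨ suc (suc qc) ∷ indices-after ρ , u ∷ points-after ρ ⟩) ∷
     (inv v , I⟨ suc (suc qc) ∷ indices-after ρ , u ∷ points-after ρ ⟩ ,
              I⟨ 1 ∷ suc qc ∷ indices-after ρ , u ∷ v ∷ points-after ρ ⟩) ∷
     (ι * inv (v * (v - u)) , I⟨ suc qc ∷ indices-after ρ , u ∷ points-after ρ ⟩ ,
                              I⟨ suc qc ∷ indices-after ρ , v ∷ points-after ρ ⟩) ∷ [])
  tail-2c qc ρ {u} {v} v≢0 u-regular v-regular v-u≢0 = at-every-bound λ lo _ →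
    IsLinear.lift (Σ-is-linear (suc lo) N) id
      ((𝐍 , u ⊙ A (v ⁺) F , u ⊙ A v F) ∷ [])
      ((inv (v - u) , v ⊙ F , u ⊙ F) ∷ (inv v , u ⊙ F , u ⊙ A v D) ∷
       (ι * inv (v * (v - u)) , u ⊙ D , v ⊙ D) ∷ [])
      (λ n lo<n<N → weighted-Δ-long {D = D} (L^-comm qc (R ρ)) v≢0 v-regular u-regular v-u≢0 n
         (ℕₚ.≤-trans (s≤s z≤n) (proj₁ lo<n<N)) (proj₂ lo<n<N))
    where
    F = L^ qc (L (R ρ))
    D = L^ qc (R ρ)

  tail-2d : ∀ ρ {u v} → v ≢ 0ℚ → NoPole u → NoPole v → Admissible ρ → v - u ≢ 0ℚ →
    v ⁺ - x-after ρ ≢ 0ℚ → TailIdentity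
    ((𝐍 , I⟨ 1 ∷ 1 ∷ indices-after ρ , u ∷ v ⁺ ∷ points-after ρ ⟩ ,
          I⟨ 1 ∷ 1 ∷ indices-after ρ , u ∷ v ∷ points-after ρ ⟩) ∷ [])
    ((inv (v - u) , I⟨ 1 ∷ indices-after ρ , v ∷ points-after ρ ⟩ ,
                    I⟨ 1 ∷ indices-after ρ , u ∷ points-after ρ ⟩) ∷
     (inv (v ⁺ - x-after ρ) , I⟨ 1 ∷ indices-after ρ , u ∷ points-after ρ ⟩ ,
                              (1 , u) ◃ shifted (v ⁺) ρ) ∷ [])
  tail-2d ρ {u} {v} v≢0 u-regular v-regular ρ-admissible v-u≢0 v⁺-next≢0 =
    at-every-bound λ lo _ →
    IsLinear.lift (Σ-is-linear (suc lo) N) id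
      ((𝐍 , u ⊙ A (v ⁺) (R ρ) , u ⊙ A v (R ρ)) ∷ [])
      ((inv (v - u) , v ⊙ R ρ , u ⊙ R ρ) ∷
       (inv (v ⁺ - x-after ρ) , u ⊙ R ρ , u ⊙ R⁺ v ρ) ∷ [])
      (λ n lo<n<N → weighted-Δ-singleton ρ v≢0 v-regular ρ-admissible v⁺-next≢0 u-regular v-u≢0 n
         (ℕₚ.≤-trans (s≤s z≤n) (proj₁ lo<n<N)) (proj₂ lo<n<N))

  -- The hypotheses on the index, on length b ≡ length z and on poles at the shifted point are not
  -- needed: the identities hold for all lists, and g (v + 1/N) is only ever evaluated through g v.
  case1a : Case1a N
  case1a _ b x z (s≤s (s≤s (z≤n {pc}))) _ _ (x-regular ∷ _) _ x≢0 = begin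
    𝐍 * (I N (suc (suc pc) ∷ b) (x ⁺ ∷ z) - I N (suc (suc pc) ∷ b) (x ∷ z))
      ≡⟨ cong₂ (λ s t → 𝐍 * (s - t)) (I-as-Iᴷ 0 (suc (suc pc) ∷ b) (x ⁺ ∷ z))
                                     (I-as-Iᴷ 0 (suc (suc pc) ∷ b) (x ∷ z)) ⟩
    𝐍 * (A (x ⁺) (L^ pc (L Rb)) 0 - A x (L^ pc (L Rb)) 0)
      ≡⟨ first-block-long {D = L^ pc Rb} (L^-comm pc Rb) x≢0 x-regular ⟩
    - (inv x * A x (L^ pc Rb) 0)
      ≡⟨ cong (λ t → - (inv x * t)) (I-as-Iᴷ 0 (suc pc ∷ b) (x ∷ z)) ⟨
    - (inv x * I N (suc pc ∷ b) (x ∷ z)) ∎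
    where
    Rb = Iᴷ 𝟏 b z

  case1b : Case1b N
  case1b x (x-regular ∷ []) _ x≢0 x⁺-1≢0 = begin
    𝐍 * (I N [ 1 ] [ x ⁺ ] - I N [ 1 ] [ x ])
      ≡⟨ cong₂ (λ s t → 𝐍 * (s - t)) (I-as-Iᴷ 0 [ 1 ] [ x ⁺ ]) (I-as-Iᴷ 0 [ 1 ] [ x ]) ⟩
    𝐍 * (A (x ⁺) 𝟏 0 - A x 𝟏 0)
      ≡⟨ first-block-singleton end x≢0 x-regular tt x⁺-1≢0 ⟩
    - (inv x * 1ℚ) + inv (x ⁺ - 1ℚ) * (1ℚ - 0ℚ)
      ≡⟨ simplify (inv x) (inv (x ⁺ - 1ℚ)) ⟩
    inv (x ⁺ - 1ℚ) - inv x ∎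
    where
    simplify : ∀ a b → - (a * 1ℚ) + b * (1ℚ - 0ℚ) ≡ b - a
    simplify = solve-∀ ℚ-ring

  case1c : Case1c N
  case1c k b x w z _ _ _ (x-regular ∷ w-regular ∷ _) _ x≢0 x⁺-w≢0 = begin
    𝐍 * (I N (1 ∷ k ∷ b) (x ⁺ ∷ w ∷ z) - I N (1 ∷ k ∷ b) (x ∷ w ∷ z))
      ≡⟨ cong₂ (λ s t → 𝐍 * (s - t)) (I-as-Iᴷ 0 (1 ∷ k ∷ b) (x ⁺ ∷ w ∷ z))
                                     (I-as-Iᴷ 0 (1 ∷ k ∷ b) (x ∷ w ∷ z)) ⟩
    𝐍 * (A (x ⁺) (R ρ) 0 - A x (R ρ) 0)
      ≡⟨ first-block-singleton ρ x≢0 x-regular w-regular x⁺-w≢0 ⟩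
    - (inv x * R ρ 0) + inv (x ⁺ - w) * (R ρ 0 - R⁺ x ρ 0)
      ≡⟨ cong₂ (λ s t → - (inv x * s) + inv (x ⁺ - w) * (s - t))
           (I-as-Iᴷ 0 (k ∷ b) (w ∷ z)) (I-as-Iᴷ 0 (k ∷ b) (x ⁺ ∷ z)) ⟨
    - (inv x * I N (k ∷ b) (w ∷ z))
      + inv (x ⁺ - w) * (I N (k ∷ b) (w ∷ z) - I N (k ∷ b) (x ⁺ ∷ z)) ∎
    where
    ρ = next k b w z

  case2a : Case2a N
  case2a a _ _ c b y u v w z (_ , a≍y , _ , poles , _ , v≢0)
         (s≤s (s≤s (z≤n {pc}))) (s≤s (s≤s (z≤n {qc}))) =
    prefix-extension a y a≍y (tail-2a pc qc (next c b w z) v≢0 (head (tail regular)))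
    where regular = ++⁻ʳ y {u ∷ v ∷ w ∷ z} poles

  case2b : Case2b N
  case2b a _ c b y u v w z (_ , a≍y , _ , poles , _ , v≢0) (s≤s (s≤s (z≤n {pc}))) v⁺-w≢0 =
    prefix-extension a y a≍y
      (tail-2b pc (next c b w z) v≢0 (head (tail regular)) (head (tail (tail regular))) v⁺-w≢0)
    where regular = ++⁻ʳ y {u ∷ v ∷ w ∷ z} poles

  case2c : Case2c N
  case2c a _ c b y u v w z (_ , a≍y , _ , poles , _ , v≢0) (s≤s (s≤s (z≤n {qc}))) v-u≢0 =
    prefix-extension a y a≍y
      (tail-2c qc (next c b w z) v≢0 (head regular) (head (tail regular)) v-u≢0)
    where regular = ++⁻ʳ y {u ∷ v ∷ w ∷ z} poles

  case2d : Case2d N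
  case2d a c b y u v w z (_ , a≍y , _ , poles , _ , v≢0) v-u≢0 v⁺-w≢0 =
    prefix-extension a y a≍y (tail-2d (next c b w z) v≢0 (head regular) (head (tail regular))
                                (head (tail (tail regular))) v-u≢0 v⁺-w≢0)
    where regular = ++⁻ʳ y {u ∷ v ∷ w ∷ z} poles

  case3a : Case3a N
  case3a a _ _ y u v (_ , a≍y , poles , _ , v≢0)
         (s≤s (s≤s (z≤n {pc}))) (s≤s (s≤s (z≤n {qc}))) =
    prefix-extension a y a≍y (tail-2a pc qc end v≢0 (head (tail regular)))
    where regular = ++⁻ʳ y {u ∷ v ∷ []} poles

  case3b : Case3b N
  case3b a _ y u v (_ , a≍y , poles , _ , v≢0) (s≤s (s≤s (z≤n {pc}))) v⁺-1≢0 =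
    prefix-extension a y a≍y (tail-2b pc end v≢0 (head (tail regular)) tt v⁺-1≢0)
    where regular = ++⁻ʳ y {u ∷ v ∷ []} poles

  case3c : Case3c N
  case3c a _ y u v (_ , a≍y , poles , _ , v≢0) (s≤s (s≤s (z≤n {qc}))) v-u≢0 =
    prefix-extension a y a≍y (tail-2c qc end v≢0 (head regular) (head (tail regular)) v-u≢0)
    where regular = ++⁻ʳ y {u ∷ v ∷ []} poles

  case3d : Case3d N
  case3d a y u v (_ , a≍y , poles , _ , v≢0) v-u≢0 v⁺-1≢0 =
    prefix-extension a y a≍y
      (tail-2d end v≢0 (head regular) (head (tail regular)) tt v-u≢0 v⁺-1≢0)
    where regular = ++⁻ʳ y {u ∷ v ∷ []} poles

theorem1p4 : (N : ℕ) → 0 < N →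
    (Case1a N × Case1b N × Case1c N) ×
    (Case2a N × Case2b N × Case2c N × Case2d N) ×
    (Case3a N × Case3b N × Case3c N × Case3d N)
theorem1p4 (suc h) _ =
  (case1a , case1b , case1c) , (case2a , case2b , case2c , case2d) , (case3a , case3b , case3c , case3d)
  where open Truncated h
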